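{- For every $k\ge1$, with $d'=\lceil\log_2 k\rceil$, in F-MMR the amortized number of range-node ancestors and the amortized proof size of the $k$-th newest leaf are $$\bar r_{\mathrm{F\text{ - }MMR}}(k)=\frac12d'+\frac{k}{2^{d'}},\qquad \bar\sigma_{\mathrm{F\text{ - }MMR}}(k)=\frac32d'+\frac{3k}{2^{d'}}-1=\frac32\log_2k+O(1),$$ where the amortized value of a function $f(k,n)$ is $\bar f(k):=\lim_{N\to\infty}\frac1N\sum_{n=k}^{k+N-1}f(k,n)$.
   Context: A mountain of height $s\ge0$ is a perfect binary tree with $2^s$ leaves; its root is its peak. The U-MMR with $n$ leaves is the ordered (left-to-right) list of mountains, one of height $i$ for each 1-bit at position $i$ of the binary representation of $n$, in decreasing order of height left to right, whose leaves read left to right are $h_1,\dots,h_n$. The F-MMR forward-bags the peaks $P_1,\dots,P_t$ (left to right): range nodes $R_1$ (single child $P_1$) and $R_j$ with children $R_{j-1},P_j$; the root is $R_t$. For $1\le k\le n$: $r_{\mathrm{F\text{ - }MMR}}(k,n)$ is the number of ancestors of $h_{n-k+1}$ that are range nodes, and $\sigma_{\mathrm{F\text{ - }MMR}}(k,n)$ is the number of hashes in the membership proof of $h_{n-k+1}$, i.e., the siblings of the nodes on its path to the root, where a node without a sibling contributes no hash. -}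

module Defs where

open import Data.Nat using (ℕ; zero; suc; _+_; _*_; _∸_; _^_; _≤_; _<ᵇ_; NonZero)
open import Data.Nat.Properties using (m^n≢0)
open import Data.Nat.DivMod using (_/_; _%_)
open import Data.Nat.Logarithm using (⌈log₂_⌉)
open import Data.Bool using (Bool; true; false; if_then_else_)
open import Data.List using (List; []; _∷_; _++_)
open import Data.Integer using (+_)
open import Data.Product using (∃-syntax; _×_)
open import Data.Rational as ℚ using (ℚ; 0ℚ; 1ℚ; ∣_∣) renaming (_/_ to _÷_)

-- Trees occurring in an F-MMR.
--   leaf        : a leaf hash h_i
--   node l r    : an internal node of a mountain (perfect binary tree)
--   range₁ c    : the range node R₁ (single child P₁)
--   range₂ l r  : the range node R_j (children R_{j-1}, P_j)

data Tree : Set where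
  leaf   : Tree
  node   : Tree → Tree → Tree
  range₁ : Tree → Tree
  range₂ : Tree → Tree → Tree

size : Tree → ℕ
size leaf         = 1
size (node l r)   = size l + size r
size (range₁ c)   = size c
size (range₂ l r) = size l + size r

mountain : ℕ → Tree
mountain zero    = leaf
mountain (suc s) = node (mountain s) (mountain s)

-- positions of 1-bits of m, ascending, offset by i (fuel f suffices when f ≥ m)
bitsFrom : ℕ → ℕ → ℕ → List ℕ
bitsFrom zero    i m = []
bitsFrom (suc f) i m with m % 2
... | zero  = bitsFrom f (suc i) (m / 2)
... | suc _ = bitsFrom f (suc i) (m / 2) ++ (i ∷ [])
-- (appending makes the result descending)

-- heights of the mountains of the U-MMR with n leaves, left to right
-- (i.e. positions of the 1-bits of n in decreasing order)
peakHeights : ℕ → List ℕ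
peakHeights n = bitsFrom n 0 n

mountains : ℕ → List Tree
mountains n = Data.List.map mountain (peakHeights n)

bagFrom : Tree → List Tree → Tree
bagFrom acc []       = acc
bagFrom acc (p ∷ ps) = bagFrom (range₂ acc p) ps

forwardBag : List Tree → Tree
forwardBag []       = leaf   -- only reached for n = 0 (no tree); never used below
forwardBag (p ∷ ps) = bagFrom (range₁ p) ps

fmmr : ℕ → Tree
fmmr n = forwardBag (mountains n)

rangeAncestors : Tree → ℕ → ℕ
rangeAncestors leaf         i = 0
rangeAncestors (node l r)   i =
  if i <ᵇ size l then rangeAncestors l i else rangeAncestors r (i ∸ size l)
rangeAncestors (range₁ c)   i = suc (rangeAncestors c i)
rangeAncestors (range₂ l r) i = suc
  (if i <ᵇ size l then rangeAncestors l i else rangeAncestors r (i ∸ size l))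

-- number of hashes in the membership proof of the leaf with 0-based index i:
-- one hash for each node on the path (below the root) that has a sibling
proofSize : Tree → ℕ → ℕ
proofSize leaf         i = 0
proofSize (node l r)   i =
  suc (if i <ᵇ size l then proofSize l i else proofSize r (i ∸ size l))
proofSize (range₁ c)   i = proofSize c i   -- the only child has no sibling
proofSize (range₂ l r) i =
  suc (if i <ᵇ size l then proofSize l i else proofSize r (i ∸ size l))

-- r_{F-MMR}(k,n), σ_{F-MMR}(k,n): leaf h_{n-k+1} has 0-based index n ∸ k
rFMMR : ℕ → ℕ → ℕ
rFMMR k n = rangeAncestors (fmmr n) (n ∸ k)

σFMMR : ℕ → ℕ → ℕ
σFMMR k n = proofSize (fmmr n) (n ∸ k)

windowSum : (ℕ → ℕ → ℕ) → ℕ → ℕ → ℕ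
windowSum f k zero    = 0
windowSum f k (suc N) = windowSum f k N + f k (k + N)

average : (ℕ → ℕ → ℕ) → ℕ → ℕ → ℚ
average f k M = (+ windowSum f k (suc M)) ÷ suc M

ConvergesTo : (ℕ → ℚ) → ℚ → Set
ConvergesTo a L = ∀ (ε : ℚ) → 0ℚ ℚ.< ε →
  ∃[ M₀ ] (∀ M → M₀ ≤ M → ∣ a M ℚ.- L ∣ ℚ.< ε)

AmortizedValue : (ℕ → ℕ → ℕ) → ℕ → ℚ → Set
AmortizedValue f k L = ConvergesTo (average f k) L

_over2^_ : ℕ → ℕ → ℚ
m over2^ d = _÷_ (+ m) (2 ^ d) {{m^n≢0 2 d}}

{-# OPTIONS --safe #-}
module Submission where

-- The F-MMR with 2j leaves is the F-MMR with j leaves in which every leaf is replaced by a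
-- pair of leaves; with 2j + 1 leaves, one more mountain of height 0 is bagged on the right.
-- Following the k-th newest leaf through this correspondence gives, for 1 ≤ k ≤ n (k ≥ 2 in
-- the odd case), r(k, 2j) = r(⌈k/2⌉, j), r(k, 2j+1) = 1 + r(⌊k/2⌋, j), σ(k, 2j) = 1 + σ(⌈k/2⌉, j),
-- σ(k, 2j+1) = 2 + σ(⌊k/2⌋, j). For any f with such recurrences (increments α and β) the
-- partial sums F_c(T) = Σ_{c ≤ n < T} f(c, n) satisfy
--   F_c(2T) = F_⌈c/2⌉(T) + F_⌊c/2⌋(T) + α (T − ⌈c/2⌉) + β (T − ⌊c/2⌋),
-- so induction on D, where c ≤ 2^D ≤ 2c, gives 2^(D+1) F_c(T) = (α + β)(D 2^D + 2c) T + o(T)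
-- as soon as F_1(T) = (α + β) T + o(T). This holds for r, since r(1, n) = 1, and for σ + 1,
-- whose F_1 satisfies F_1(2T) = F_1(T) + 3T − 2 and hence F_1(T) = 3T + O(log T). The window
-- sums of the amortized value are F_k(k + N), so dividing by N gives the limits.

open import Defs

module Halving where

  open import Data.Nat
  open import Data.Nat.Properties
  open import Data.Nat.DivMod using (m/n≡1+[m∸n]/n)
  open import Data.Nat.Logarithm
  open import Function using (_∘_)
  open import Relation.Nullary using (yes; no; contradiction)
  open import Relation.Binary.PropositionalEquality
  open import Data.Nat.Tactic.RingSolver using (solve-∀)

  double : ℕ → ℕ
  double zero    = zero
  double (suc n) = suc (suc (double n))

  data Binary : ℕ → Set where
    zero : Binary 0
    even : ∀ {j} → Binary (suc j) → Binary (double (suc j))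
    odd  : ∀ {j} → Binary j → Binary (suc (double j))

  binary-suc : ∀ {n} → Binary n → Binary (suc n)
  binary-suc zero     = odd zero
  binary-suc (even b) = odd b
  binary-suc (odd b)  = even (binary-suc b)

  binary : ∀ n → Binary n
  binary zero    = zero
  binary (suc n) = binary-suc (binary n)

  double≡2* : ∀ n → double n ≡ 2 * n
  double≡2* zero    = refl
  double≡2* (suc n) = trans (cong (suc ∘ suc) (double≡2* n)) (sym (+-suc (suc n) (n + 0)))

  n≤double[n] : ∀ n → n ≤ double n
  n≤double[n] n = subst (n ≤_) (sym (double≡2* n)) (m≤m+n n (n + 0))

  double[n]%2≡0 : ∀ n → double n % 2 ≡ 0
  double[n]%2≡0 zero    = refl
  double[n]%2≡0 (suc n) = double[n]%2≡0 n

  [1+double[n]]%2≡1 : ∀ n → suc (double n) % 2 ≡ 1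
  [1+double[n]]%2≡1 zero    = refl
  [1+double[n]]%2≡1 (suc n) = [1+double[n]]%2≡1 n

  [2+n]/2≡1+n/2 : ∀ n → suc (suc n) / 2 ≡ suc (n / 2)
  [2+n]/2≡1+n/2 n = m/n≡1+[m∸n]/n {suc (suc n)} {2} (s≤s (s≤s z≤n))

  double[n]/2≡n : ∀ n → double n / 2 ≡ n
  double[n]/2≡n zero    = refl
  double[n]/2≡n (suc n) = trans ([2+n]/2≡1+n/2 (double n)) (cong suc (double[n]/2≡n n))

  [1+double[n]]/2≡n : ∀ n → suc (double n) / 2 ≡ n
  [1+double[n]]/2≡n zero    = refl
  [1+double[n]]/2≡n (suc n) = trans ([2+n]/2≡1+n/2 (suc (double n))) (cong suc ([1+double[n]]/2≡n n))

  ⌈double[n]/2⌉≡n : ∀ n → ⌈ double n /2⌉ ≡ n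
  ⌈double[n]/2⌉≡n zero    = refl
  ⌈double[n]/2⌉≡n (suc n) = cong suc (⌈double[n]/2⌉≡n n)

  ⌊double[n]/2⌋≡n : ∀ n → ⌊ double n /2⌋ ≡ n
  ⌊double[n]/2⌋≡n zero    = refl
  ⌊double[n]/2⌋≡n (suc n) = cong suc (⌊double[n]/2⌋≡n n)

  ⌊1+double[n]/2⌋≡n : ∀ n → ⌊ suc (double n) /2⌋ ≡ n
  ⌊1+double[n]/2⌋≡n zero    = refl
  ⌊1+double[n]/2⌋≡n (suc n) = cong suc (⌊1+double[n]/2⌋≡n n)

  ⌈1+double[n]/2⌉≡1+n : ∀ n → ⌈ suc (double n) /2⌉ ≡ suc n
  ⌈1+double[n]/2⌉≡1+n n = cong suc (⌊double[n]/2⌋≡n n)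

  m≤double[n]⇒⌈m/2⌉≤n : ∀ {c} j → c ≤ double j → ⌈ c /2⌉ ≤ j
  m≤double[n]⇒⌈m/2⌉≤n {c} j c≤2j = subst (⌈ c /2⌉ ≤_) (⌈double[n]/2⌉≡n j) (⌈n/2⌉-mono c≤2j)

  m≤1+double[n]⇒⌊m/2⌋≤n : ∀ {c} j → c ≤ suc (double j) → ⌊ c /2⌋ ≤ j
  m≤1+double[n]⇒⌊m/2⌋≤n {c} j c≤2j+1 =
    subst (⌊ c /2⌋ ≤_) (⌊1+double[n]/2⌋≡n j) (⌊n/2⌋-mono c≤2j+1)

  n≤double⌈n/2⌉ : ∀ c → c ≤ double ⌈ c /2⌉
  n≤double⌈n/2⌉ zero          = z≤n
  n≤double⌈n/2⌉ (suc zero)    = s≤s z≤n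
  n≤double⌈n/2⌉ (suc (suc c)) = s≤s (s≤s (n≤double⌈n/2⌉ c))

  double⌈n/2⌉≤1+n : ∀ c → double ⌈ c /2⌉ ≤ suc c
  double⌈n/2⌉≤1+n zero          = z≤n
  double⌈n/2⌉≤1+n (suc zero)    = ≤-refl
  double⌈n/2⌉≤1+n (suc (suc c)) = s≤s (s≤s (double⌈n/2⌉≤1+n c))

  double[⌈n/2⌉∸1]≤n∸1 : ∀ c → double (⌈ c /2⌉ ∸ 1) ≤ c ∸ 1
  double[⌈n/2⌉∸1]≤n∸1 zero          = z≤n
  double[⌈n/2⌉∸1]≤n∸1 (suc zero)    = z≤n
  double[⌈n/2⌉∸1]≤n∸1 (suc (suc c)) = double⌈n/2⌉≤1+n c

  2*m*n≡m*double[n] : ∀ b x → 2 * b * x ≡ b * double x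
  2*m*n≡m*double[n] b x = trans (arith b x) (cong (b *_) (sym (double≡2* x)))
    where
    arith : ∀ b x → 2 * b * x ≡ b * (2 * x)
    arith = solve-∀

  atLeast : ℕ → ℕ → ℕ
  atLeast zero    n       = 1
  atLeast (suc c) zero    = 0
  atLeast (suc c) (suc n) = atLeast c n

  atLeast-double : ∀ c j → atLeast c (double j) ≡ atLeast ⌈ c /2⌉ j
  atLeast-double zero          j       = refl
  atLeast-double (suc zero)    zero    = refl
  atLeast-double (suc zero)    (suc j) = refl
  atLeast-double (suc (suc c)) zero    = refl
  atLeast-double (suc (suc c)) (suc j) = atLeast-double c j

  atLeast-suc-double : ∀ c j → atLeast c (suc (double j)) ≡ atLeast ⌊ c /2⌋ j
  atLeast-suc-double zero          j       = refl
  atLeast-suc-double (suc zero)    j       = refl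
  atLeast-suc-double (suc (suc c)) zero    = refl
  atLeast-suc-double (suc (suc c)) (suc j) = atLeast-suc-double c j

  atLeast-*-cong : ∀ c n {x y} → (c ≤ n → x ≡ y) → atLeast c n * x ≡ atLeast c n * y
  atLeast-*-cong zero    n       x≡y = cong (1 *_) (x≡y z≤n)
  atLeast-*-cong (suc c) zero    _   = refl
  atLeast-*-cong (suc c) (suc n) x≡y = atLeast-*-cong c n (x≡y ∘ s≤s)

  atLeast-< : ∀ {c T} → T < c → atLeast c T ≡ 0
  atLeast-< {suc c} {zero}  _         = refl
  atLeast-< {suc c} {suc T} (s≤s T<c) = atLeast-< T<c

  atLeast-+ : ∀ k N → atLeast k (k + N) ≡ 1
  atLeast-+ zero    N = refl
  atLeast-+ (suc k) N = atLeast-+ k N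

  atLeast-+-∸ : ∀ c T → (T ∸ c) + atLeast c T ≡ suc T ∸ c
  atLeast-+-∸ zero    T       = +-comm T 1
  atLeast-+-∸ (suc c) zero    = sym (0∸n≡0 c)
  atLeast-+-∸ (suc c) (suc T) = atLeast-+-∸ c T

  record LogBracket (D c : ℕ) : Set where
    field
      pos   : 1 ≤ c
      below : c ≤ 2 ^ D
      above : 2 ^ D ≤ 2 * c

  ⌈log₂⌉-⌈/2⌉ : ∀ {n} → 2 ≤ n → suc ⌈log₂ ⌈ n /2⌉ ⌉ ≡ ⌈log₂ n ⌉
  ⌈log₂⌉-⌈/2⌉ {n} 2≤n =
    trans (cong suc (⌈log₂⌈n/2⌉⌉≡⌈log₂n⌉∸1 n)) (m+[n∸m]≡n (⌈log₂⌉-mono-≤ 2≤n))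

  ⌈log₂1+2^n⌉ : ∀ n → ⌈log₂ suc (2 ^ n) ⌉ ≡ suc n
  ⌈log₂1+2^n⌉ zero    = refl
  ⌈log₂1+2^n⌉ (suc n) = begin
    ⌈log₂ suc (2 ^ suc n) ⌉
      ≡⟨ ⌈log₂⌉-⌈/2⌉ (s≤s (m^n>0 2 (suc n))) ⟨
    suc ⌈log₂ ⌈ suc (2 ^ suc n) /2⌉ ⌉
      ≡⟨ cong (λ x → suc ⌈log₂ ⌈ suc x /2⌉ ⌉) (double≡2* (2 ^ n)) ⟨
    suc ⌈log₂ ⌈ suc (double (2 ^ n)) /2⌉ ⌉
      ≡⟨ cong (λ x → suc ⌈log₂ x ⌉) (⌈1+double[n]/2⌉≡1+n (2 ^ n)) ⟩
    suc ⌈log₂ suc (2 ^ n) ⌉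
      ≡⟨ cong suc (⌈log₂1+2^n⌉ n) ⟩
    suc (suc n) ∎
    where open ≡-Reasoning

  ⌈log₂⌉-bracket : ∀ {k} → 1 ≤ k → LogBracket ⌈log₂ k ⌉ k
  ⌈log₂⌉-bracket {k} 1≤k = record { pos = 1≤k ; below = below ; above = above ⌈log₂ k ⌉ refl }
    where
    below : k ≤ 2 ^ ⌈log₂ k ⌉
    below with k ≤? 2 ^ ⌈log₂ k ⌉
    ... | yes k≤ = k≤
    ... | no  k≰ = contradiction (⌈log₂⌉-mono-≤ (≰⇒> k≰))
      (subst (_≰ ⌈log₂ k ⌉) (sym (⌈log₂1+2^n⌉ _)) (<-irrefl refl))
    above : ∀ D → ⌈log₂ k ⌉ ≡ D → 2 ^ D ≤ 2 * k
    above zero    _  = ≤-trans 1≤k (m≤m+n k (k + 0))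
    above (suc D) eq with 2 ^ suc D ≤? 2 * k
    ... | yes ≤2k = ≤2k
    ... | no  ≰2k = contradiction (⌈log₂⌉-mono-≤ (<⇒≤ (*-cancelˡ-< 2 k (2 ^ D) (≰⇒> ≰2k))))
      (subst₂ _≰_ (sym eq) (sym (⌈log₂2^n⌉≡n D)) (<-irrefl refl))

  LogBracket-⌊/2⌋ : ∀ {D c} → 2 ≤ c → LogBracket (suc D) c → LogBracket D ⌊ c /2⌋
  LogBracket-⌊/2⌋ {D} {c} 2≤c br =
    record { pos = ⌊n/2⌋-mono 2≤c ; below = below ; above = above D (LogBracket.above br) }
    where
    below : ⌊ c /2⌋ ≤ 2 ^ D
    below = ≤-trans (⌊n/2⌋-mono (LogBracket.below br))
      (≤-reflexive (trans (cong ⌊_/2⌋ (sym (double≡2* (2 ^ D)))) (⌊double[n]/2⌋≡n (2 ^ D))))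
    above : ∀ D → 2 ^ suc D ≤ 2 * c → 2 ^ D ≤ 2 * ⌊ c /2⌋
    above zero    _ = ≤-trans (⌊n/2⌋-mono 2≤c) (m≤m+n _ _)
    above (suc D) ≤2c = *-monoʳ-≤ 2 (subst (_≤ ⌊ c /2⌋) (⌊double[n]/2⌋≡n (2 ^ D))
      (⌊n/2⌋-mono (subst (_≤ c) (sym (double≡2* (2 ^ D))) (*-cancelˡ-≤ 2 ≤2c))))

  LogBracket-⌈/2⌉ : ∀ {D c} → 2 ≤ c → LogBracket (suc D) c → LogBracket D ⌈ c /2⌉
  LogBracket-⌈/2⌉ {D} {c} 2≤c br = record
    { pos   = ⌈n/2⌉-mono (LogBracket.pos br)
    ; below = ≤-trans (⌈n/2⌉-mono (LogBracket.below br))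
        (≤-reflexive (trans (cong ⌈_/2⌉ (sym (double≡2* (2 ^ D)))) (⌈double[n]/2⌉≡n (2 ^ D))))
    ; above = ≤-trans (LogBracket.above (LogBracket-⌊/2⌋ 2≤c br)) (*-monoʳ-≤ 2 (⌊n/2⌋≤⌈n/2⌉ c))
    }

module ScaledFMMR where

  open Halving
  open import Data.Nat
  open import Data.Nat.Properties
  open import Data.Bool using (true; false; if_then_else_)
  open import Data.List using (List; []; _∷_; _++_; map)
  open import Data.List.Properties using (map-++; ++-conicalʳ)
  open import Function using (_∘_)
  open import Relation.Nullary using (ofʸ; ofⁿ; contradiction)
  open import Relation.Binary.PropositionalEquality
  open import Data.Nat.Tactic.RingSolver using (solve-∀)

  bitsFrom-zero : ∀ f i → bitsFrom f i 0 ≡ []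
  bitsFrom-zero zero    i = refl
  bitsFrom-zero (suc f) i = bitsFrom-zero f (suc i)

  bitsFrom-double : ∀ f i j → bitsFrom (suc f) i (double j) ≡ bitsFrom f (suc i) j
  bitsFrom-double f i j rewrite double[n]%2≡0 j | double[n]/2≡n j = refl

  bitsFrom-suc-double : ∀ f i j → bitsFrom (suc f) i (suc (double j)) ≡ bitsFrom f (suc i) j ++ i ∷ []
  bitsFrom-suc-double f i j rewrite [1+double[n]]%2≡1 j | [1+double[n]]/2≡n j = refl

  bitsFrom-fuel : ∀ {f f′ m} i → Binary m → m ≤ f → m ≤ f′ → bitsFrom f i m ≡ bitsFrom f′ i m
  bitsFrom-fuel {f} {f′} i zero _ _ = trans (bitsFrom-zero f i) (sym (bitsFrom-zero f′ i))
  bitsFrom-fuel {suc f} {suc f′} i (even {j} b) (s≤s m≤f) (s≤s m≤f′) = begin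
    bitsFrom (suc f) i (double (suc j))   ≡⟨ bitsFrom-double f i (suc j) ⟩
    bitsFrom f (suc i) (suc j)            ≡⟨ bitsFrom-fuel (suc i) b (half m≤f) (half m≤f′) ⟩
    bitsFrom f′ (suc i) (suc j)           ≡⟨ bitsFrom-double f′ i (suc j) ⟨
    bitsFrom (suc f′) i (double (suc j))  ∎
    where
    open ≡-Reasoning
    half : ∀ {g} → suc (double j) ≤ g → suc j ≤ g
    half = ≤-trans (s≤s (n≤double[n] j))
  bitsFrom-fuel {suc f} {suc f′} i (odd {j} b) (s≤s m≤f) (s≤s m≤f′) = begin
    bitsFrom (suc f) i (suc (double j))   ≡⟨ bitsFrom-suc-double f i j ⟩
    bitsFrom f (suc i) j ++ i ∷ []
      ≡⟨ cong (_++ i ∷ []) (bitsFrom-fuel (suc i) b (half m≤f) (half m≤f′)) ⟩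
    bitsFrom f′ (suc i) j ++ i ∷ []       ≡⟨ bitsFrom-suc-double f′ i j ⟨
    bitsFrom (suc f′) i (suc (double j))  ∎
    where
    open ≡-Reasoning
    half : ∀ {g} → double j ≤ g → j ≤ g
    half = ≤-trans (n≤double[n] j)

  peaksFrom : ℕ → ℕ → List ℕ
  peaksFrom i m = bitsFrom m i m

  peaksFrom-double : ∀ i j → peaksFrom i (double j) ≡ peaksFrom (suc i) j
  peaksFrom-double i zero    = refl
  peaksFrom-double i (suc j) = trans (bitsFrom-double (suc (double j)) i (suc j))
    (bitsFrom-fuel (suc i) (binary (suc j)) (s≤s (n≤double[n] j)) ≤-refl)

  peaksFrom-suc-double : ∀ i j → peaksFrom i (suc (double j)) ≡ peaksFrom (suc i) j ++ i ∷ []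
  peaksFrom-suc-double i j = trans (bitsFrom-suc-double (double j) i j)
    (cong (_++ i ∷ []) (bitsFrom-fuel (suc i) (binary j) (n≤double[n] j) ≤-refl))

  peaksFrom-≢[] : ∀ {m} i → Binary m → 0 < m → peaksFrom i m ≢ []
  peaksFrom-≢[] i (even {j} b) _ = peaksFrom-≢[] (suc i) b z<s ∘ trans (sym (peaksFrom-double i (suc j)))
  peaksFrom-≢[] i (odd {j} b)  _ e
    with ++-conicalʳ (peaksFrom (suc i) j) (i ∷ []) (trans (sym (peaksFrom-suc-double i j)) e)
  ... | ()

  -- The F-MMR with m leaves in which every leaf is replaced by a mountain of height i.
  scaledFMMR : ℕ → ℕ → Tree
  scaledFMMR i m = forwardBag (map mountain (peaksFrom i m))

  bagFrom-snoc : ∀ acc ps q → bagFrom acc (ps ++ q ∷ []) ≡ range₂ (bagFrom acc ps) q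
  bagFrom-snoc acc []       q = refl
  bagFrom-snoc acc (p ∷ ps) q = bagFrom-snoc (range₂ acc p) ps q

  forwardBag-snoc : ∀ ps q → ps ≢ [] → forwardBag (ps ++ q ∷ []) ≡ range₂ (forwardBag ps) q
  forwardBag-snoc []       q ps≢[] = contradiction refl ps≢[]
  forwardBag-snoc (p ∷ ps) q _     = bagFrom-snoc (range₁ p) ps q

  scaledFMMR-double : ∀ i j → scaledFMMR i (double j) ≡ scaledFMMR (suc i) j
  scaledFMMR-double i j = cong (forwardBag ∘ map mountain) (peaksFrom-double i j)

  scaledFMMR-suc-double : ∀ i j →
    scaledFMMR i (suc (double (suc j))) ≡ range₂ (scaledFMMR (suc i) (suc j)) (mountain i)
  scaledFMMR-suc-double i j = begin
    forwardBag (map mountain (peaksFrom i (suc (double (suc j)))))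
      ≡⟨ cong (forwardBag ∘ map mountain) (peaksFrom-suc-double i (suc j)) ⟩
    forwardBag (map mountain (ps ++ i ∷ []))
      ≡⟨ cong forwardBag (map-++ mountain ps (i ∷ [])) ⟩
    forwardBag (map mountain ps ++ mountain i ∷ [])
      ≡⟨ forwardBag-snoc (map mountain ps) (mountain i) (map≢[] (peaksFrom-≢[] (suc i) (binary (suc j)) z<s)) ⟩
    range₂ (scaledFMMR (suc i) (suc j)) (mountain i) ∎
    where
    open ≡-Reasoning
    ps = peaksFrom (suc i) (suc j)
    map≢[] : ∀ {xs} → xs ≢ [] → map mountain xs ≢ []
    map≢[] {[]}    xs≢[] _ = xs≢[] refl
    map≢[] {_ ∷ _} _     ()

  size-mountain : ∀ s → size (mountain s) ≡ 2 ^ s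
  size-mountain zero    = refl
  size-mountain (suc s) = cong₂ _+_ (size-mountain s) (trans (size-mountain s) (sym (+-identityʳ _)))

  rangeAncestors-mountain : ∀ s x → rangeAncestors (mountain s) x ≡ 0
  rangeAncestors-mountain zero    x = refl
  rangeAncestors-mountain (suc s) x with x <ᵇ size (mountain s)
  ... | true  = rangeAncestors-mountain s x
  ... | false = rangeAncestors-mountain s _

  proofSize-mountain : ∀ s x → proofSize (mountain s) x ≡ s
  proofSize-mountain zero    x = refl
  proofSize-mountain (suc s) x with x <ᵇ size (mountain s)
  ... | true  = cong suc (proofSize-mountain s x)
  ... | false = cong suc (proofSize-mountain s _)

  size-scaledFMMR : ∀ {m} i → Binary m → 0 < m → size (scaledFMMR i m) ≡ m * 2 ^ i
  size-scaledFMMR i (even {j} b) _ = begin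
    size (scaledFMMR i (double (suc j)))  ≡⟨ cong size (scaledFMMR-double i (suc j)) ⟩
    size (scaledFMMR (suc i) (suc j))     ≡⟨ size-scaledFMMR (suc i) b z<s ⟩
    suc j * (2 * 2 ^ i)                   ≡⟨ arith (suc j) (2 ^ i) ⟩
    2 * suc j * 2 ^ i                     ≡⟨ cong (_* 2 ^ i) (double≡2* (suc j)) ⟨
    double (suc j) * 2 ^ i                ∎
    where
    open ≡-Reasoning
    arith : ∀ n p → n * (2 * p) ≡ 2 * n * p
    arith = solve-∀
  size-scaledFMMR i (odd {zero} zero) _ = trans (size-mountain i) (sym (+-identityʳ _))
  size-scaledFMMR i (odd {suc j} b) _ = begin
    size (scaledFMMR i (suc (double (suc j))))        ≡⟨ cong size (scaledFMMR-suc-double i j) ⟩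
    size (scaledFMMR (suc i) (suc j)) + size (mountain i)
      ≡⟨ cong₂ _+_ (size-scaledFMMR (suc i) b z<s) (size-mountain i) ⟩
    suc j * (2 * 2 ^ i) + 2 ^ i                       ≡⟨ arith (suc j) (2 ^ i) ⟩
    suc (2 * suc j) * 2 ^ i                           ≡⟨ cong (λ n → suc n * 2 ^ i) (double≡2* (suc j)) ⟨
    suc (double (suc j)) * 2 ^ i                      ∎
    where
    open ≡-Reasoning
    arith : ∀ n p → n * (2 * p) + p ≡ suc (2 * n) * p
    arith = solve-∀

  fromEnd : (Tree → ℕ → ℕ) → Tree → ℕ → ℕ
  fromEnd f t k = f t (size t ∸ k)

  select : (Tree → ℕ → ℕ) → Tree → Tree → ℕ → ℕ
  select f l r x = if x <ᵇ size l then f l x else f r (x ∸ size l)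

  select-< : ∀ f l r {x} → x < size l → select f l r x ≡ f l x
  select-< f l r {x} x<l with x <ᵇ size l | <ᵇ-reflects-< x (size l)
  ... | true  | _        = refl
  ... | false | ofⁿ x≮l = contradiction x<l x≮l

  select-+ : ∀ f l r d → select f l r (size l + d) ≡ f r d
  select-+ f l r d with size l + d <ᵇ size l | <ᵇ-reflects-< (size l + d) (size l)
  ... | true  | ofʸ l+d<l = contradiction l+d<l (m+n≮m (size l) d)
  ... | false | _         = cong (f r) (m+n∸m≡n (size l) d)

  select-right : ∀ f l r {k} → k ≤ size r → select f l r (size l + size r ∸ k) ≡ fromEnd f r k
  select-right f l r k≤r = trans (cong (select f l r) (+-∸-assoc (size l) k≤r)) (select-+ f l r _)

  select-left : ∀ f l r {k} → size r < k → k ≤ size l + size r →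
    select f l r (size l + size r ∸ k) ≡ fromEnd f l (k ∸ size r)
  select-left f l r {k} r<k k≤l+r = trans (cong (select f l r) index) (select-< f l r index<)
    where
    d = k ∸ size r
    index : size l + size r ∸ k ≡ size l ∸ d
    index = trans (cong₂ _∸_ (+-comm (size l) (size r)) (sym (m+[n∸m]≡n (<⇒≤ r<k))))
                  ([m+n]∸[m+o]≡n∸o (size r) (size l) d)
    index< : size l ∸ d < size l
    index< = ∸-monoʳ-< (m<n⇒0<n∸m r<k)
      (m≤n+o⇒m∸n≤o k (size r) (subst (k ≤_) (+-comm (size l) (size r)) k≤l+r))

  -- c = ⌈ k / b ⌉: counted from the end, the k-th leaf lies in the c-th block of b leaves.
  record InBlock (b c k : ℕ) : Set where
    constructor block
    field
      lower : b * (c ∸ 1) < k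
      upper : k ≤ b * c

  InBlock-self : ∀ {k} → 1 ≤ k → InBlock 1 k k
  InBlock-self {suc k} _ = block (s≤s (≤-reflexive (*-identityˡ k))) (≤-reflexive (sym (*-identityˡ (suc k))))

  InBlock-pos : ∀ {b c k} → InBlock b c k → 1 ≤ c
  InBlock-pos {c = zero}  (block lo hi) = contradiction (<-≤-trans lo hi) (<-irrefl refl)
  InBlock-pos {c = suc c} _         = s≤s z≤n

  InBlock-one : ∀ {b k} → InBlock b 1 k → k ≤ b
  InBlock-one {b} (block _ hi) = ≤-trans hi (≤-reflexive (*-identityʳ b))

  InBlock-suc-suc : ∀ {b c k} → InBlock b (suc (suc c)) k → b < k
  InBlock-suc-suc {b} {c} (block lo _) = ≤-<-trans (m≤m*n b (suc c)) lo

  InBlock⇒≤size : ∀ {i c k m} → InBlock (2 ^ i) c k → c ≤ m → k ≤ size (scaledFMMR i m)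
  InBlock⇒≤size {i} {c} {k} {m} blk c≤m =
    subst (k ≤_) (sym (size-scaledFMMR i (binary m) (≤-trans (InBlock-pos blk) c≤m)))
      (≤-trans (InBlock.upper blk) (≤-trans (*-monoʳ-≤ (2 ^ i) c≤m) (≤-reflexive (*-comm (2 ^ i) m))))

  InBlock-double : ∀ {b c k} → InBlock b c k → InBlock (2 * b) ⌈ c /2⌉ k
  InBlock-double {b} {c} (block lo hi) = block
    (≤-<-trans (≤-trans (≤-reflexive (2*m*n≡m*double[n] b _)) (*-monoʳ-≤ b (double[⌈n/2⌉∸1]≤n∸1 c))) lo)
    (≤-trans hi (≤-trans (*-monoʳ-≤ b (n≤double⌈n/2⌉ c)) (≤-reflexive (sym (2*m*n≡m*double[n] b _)))))

  InBlock-pred : ∀ {b c k} → InBlock b (suc (suc c)) k → InBlock b (suc c) (k ∸ b)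
  InBlock-pred {b} {c} {k} (block lo hi) = block
    (m+n≤o⇒m≤o∸n (suc (b * c)) (subst (λ x → suc x ≤ k) (trans (*-suc b c) (+-comm b (b * c))) lo))
    (m≤n+o⇒m∸n≤o k b (subst (k ≤_) (*-suc b (suc c)) hi))

  InBlock-shift : ∀ {b c k} → InBlock b (suc (suc c)) k → InBlock (2 * b) ⌊ suc (suc c) /2⌋ (k ∸ b)
  InBlock-shift blk = InBlock-double (InBlock-pred blk)

  module _ (f : Tree → ℕ → ℕ) (i j : ℕ) {k : ℕ} where

    select-scaled-last : k ≤ 2 ^ i →
      select f (scaledFMMR (suc i) (suc j)) (mountain i)
        (size (scaledFMMR (suc i) (suc j)) + size (mountain i) ∸ k) ≡ fromEnd f (mountain i) k
    select-scaled-last k≤2^i = select-right f _ (mountain i) (subst (k ≤_) (sym (size-mountain i)) k≤2^i)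

    select-scaled-earlier : ∀ {c} → InBlock (2 ^ i) (suc (suc c)) k → suc (suc c) ≤ suc (double (suc j)) →
      select f (scaledFMMR (suc i) (suc j)) (mountain i)
        (size (scaledFMMR (suc i) (suc j)) + size (mountain i) ∸ k)
        ≡ fromEnd f (scaledFMMR (suc i) (suc j)) (k ∸ 2 ^ i)
    select-scaled-earlier blk c≤m = begin
      select f l (mountain i) (size l + size (mountain i) ∸ k)
        ≡⟨ select-left f l (mountain i) (subst (_< k) (sym (size-mountain i)) (InBlock-suc-suc blk))
             (subst (k ≤_) (cong size (scaledFMMR-suc-double i j)) (InBlock⇒≤size blk c≤m)) ⟩
      fromEnd f l (k ∸ size (mountain i))
        ≡⟨ cong (fromEnd f l ∘ (k ∸_)) (size-mountain i) ⟩
      fromEnd f l (k ∸ 2 ^ i) ∎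
      where
      open ≡-Reasoning
      l = scaledFMMR (suc i) (suc j)

  rangeAncestors-last : ∀ i j {k} → k ≤ 2 ^ i →
    fromEnd rangeAncestors (scaledFMMR i (suc (double j))) k ≡ 1
  rangeAncestors-last i zero    _      = cong suc (rangeAncestors-mountain i _)
  rangeAncestors-last i (suc j) {k} k≤2^i =
    trans (cong (λ t → fromEnd rangeAncestors t k) (scaledFMMR-suc-double i j))
      (cong suc (trans (select-scaled-last rangeAncestors i j k≤2^i) (rangeAncestors-mountain i _)))

  rangeAncestors-earlier : ∀ i j {c k} → InBlock (2 ^ i) (suc (suc c)) k → suc (suc c) ≤ suc (double (suc j)) →
    fromEnd rangeAncestors (scaledFMMR i (suc (double (suc j)))) k
      ≡ suc (fromEnd rangeAncestors (scaledFMMR (suc i) (suc j)) (k ∸ 2 ^ i))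
  rangeAncestors-earlier i j {k = k} blk c≤m =
    trans (cong (λ t → fromEnd rangeAncestors t k) (scaledFMMR-suc-double i j))
      (cong suc (select-scaled-earlier rangeAncestors i j blk c≤m))

  proofSize-last : ∀ i j {k} → k ≤ 2 ^ i →
    fromEnd proofSize (scaledFMMR i (suc (double j))) k ≡ i + atLeast 1 j
  proofSize-last i zero    _      = trans (proofSize-mountain i _) (sym (+-identityʳ i))
  proofSize-last i (suc j) {k} k≤2^i =
    trans (cong (λ t → fromEnd proofSize t k) (scaledFMMR-suc-double i j))
      (trans (cong suc (trans (select-scaled-last proofSize i j k≤2^i) (proofSize-mountain i _))) (+-comm 1 i))

  proofSize-earlier : ∀ i j {c k} → InBlock (2 ^ i) (suc (suc c)) k → suc (suc c) ≤ suc (double (suc j)) →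
    fromEnd proofSize (scaledFMMR i (suc (double (suc j)))) k
      ≡ suc (fromEnd proofSize (scaledFMMR (suc i) (suc j)) (k ∸ 2 ^ i))
  proofSize-earlier i j {k = k} blk c≤m =
    trans (cong (λ t → fromEnd proofSize t k) (scaledFMMR-suc-double i j))
      (cong suc (select-scaled-earlier proofSize i j blk c≤m))

  rangeAncestors-scaled : ∀ {m} → Binary m → ∀ i {c k} → InBlock (2 ^ i) c k → c ≤ m →
    fromEnd rangeAncestors (scaledFMMR i m) k ≡ fromEnd rangeAncestors (fmmr m) c
  rangeAncestors-scaled _    i {zero}  blk _  = contradiction (InBlock-pos blk) λ ()
  rangeAncestors-scaled zero i {suc c} blk ()
  rangeAncestors-scaled (even {j} b) i {c} {k} blk c≤m = begin
    fromEnd rangeAncestors (scaledFMMR i (double (suc j))) k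
      ≡⟨ cong (λ t → fromEnd rangeAncestors t k) (scaledFMMR-double i (suc j)) ⟩
    fromEnd rangeAncestors (scaledFMMR (suc i) (suc j)) k
      ≡⟨ rangeAncestors-scaled b (suc i) (InBlock-double blk) ⌈c/2⌉≤ ⟩
    fromEnd rangeAncestors (fmmr (suc j)) ⌈ c /2⌉
      ≡⟨ rangeAncestors-scaled b 1 (InBlock-double (InBlock-self (InBlock-pos blk))) ⌈c/2⌉≤ ⟨
    fromEnd rangeAncestors (scaledFMMR 1 (suc j)) c
      ≡⟨ cong (λ t → fromEnd rangeAncestors t c) (scaledFMMR-double 0 (suc j)) ⟨
    fromEnd rangeAncestors (fmmr (double (suc j))) c ∎
    where
    open ≡-Reasoning
    ⌈c/2⌉≤ = m≤double[n]⇒⌈m/2⌉≤n (suc j) c≤m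
  rangeAncestors-scaled (odd {j} b) i {suc zero} blk _ =
    trans (rangeAncestors-last i j (InBlock-one blk)) (sym (rangeAncestors-last 0 j ≤-refl))
  rangeAncestors-scaled (odd {zero} b) i {suc (suc c)} blk (s≤s ())
  rangeAncestors-scaled (odd {suc j} b) i {suc (suc c)} {k} blk c≤m = begin
    fromEnd rangeAncestors (scaledFMMR i m) k
      ≡⟨ rangeAncestors-earlier i j blk c≤m ⟩
    suc (fromEnd rangeAncestors (scaledFMMR (suc i) (suc j)) (k ∸ 2 ^ i))
      ≡⟨ cong suc (rangeAncestors-scaled b (suc i) (InBlock-shift blk) ⌊c/2⌋≤) ⟩
    suc (fromEnd rangeAncestors (fmmr (suc j)) ⌊ suc (suc c) /2⌋)
      ≡⟨ cong suc (rangeAncestors-scaled b 1 (InBlock-shift self) ⌊c/2⌋≤) ⟨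
    suc (fromEnd rangeAncestors (scaledFMMR 1 (suc j)) (suc c))
      ≡⟨ rangeAncestors-earlier 0 j self c≤m ⟨
    fromEnd rangeAncestors (fmmr m) (suc (suc c)) ∎
    where
    open ≡-Reasoning
    m = suc (double (suc j))
    self = InBlock-self {suc (suc c)} (s≤s z≤n)
    ⌊c/2⌋≤ = m≤1+double[n]⇒⌊m/2⌋≤n (suc j) c≤m

  proofSize-scaled : ∀ {m} → Binary m → ∀ i {c k} → InBlock (2 ^ i) c k → c ≤ m →
    fromEnd proofSize (scaledFMMR i m) k ≡ i + fromEnd proofSize (fmmr m) c
  proofSize-scaled _    i {zero}  blk _  = contradiction (InBlock-pos blk) λ ()
  proofSize-scaled zero i {suc c} blk ()
  proofSize-scaled (even {j} b) i {c} {k} blk c≤m = begin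
    fromEnd proofSize (scaledFMMR i (double (suc j))) k
      ≡⟨ cong (λ t → fromEnd proofSize t k) (scaledFMMR-double i (suc j)) ⟩
    fromEnd proofSize (scaledFMMR (suc i) (suc j)) k
      ≡⟨ proofSize-scaled b (suc i) (InBlock-double blk) ⌈c/2⌉≤ ⟩
    suc i + fromEnd proofSize (fmmr (suc j)) ⌈ c /2⌉
      ≡⟨ +-suc i _ ⟨
    i + (1 + fromEnd proofSize (fmmr (suc j)) ⌈ c /2⌉)
      ≡⟨ cong (i +_) (proofSize-scaled b 1 (InBlock-double (InBlock-self (InBlock-pos blk))) ⌈c/2⌉≤) ⟨
    i + fromEnd proofSize (scaledFMMR 1 (suc j)) c
      ≡⟨ cong (λ t → i + fromEnd proofSize t c) (scaledFMMR-double 0 (suc j)) ⟨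
    i + fromEnd proofSize (fmmr (double (suc j))) c ∎
    where
    open ≡-Reasoning
    ⌈c/2⌉≤ = m≤double[n]⇒⌈m/2⌉≤n (suc j) c≤m
  proofSize-scaled (odd {j} b) i {suc zero} blk _ =
    trans (proofSize-last i j (InBlock-one blk)) (cong (i +_) (sym (proofSize-last 0 j ≤-refl)))
  proofSize-scaled (odd {zero} b) i {suc (suc c)} blk (s≤s ())
  proofSize-scaled (odd {suc j} b) i {suc (suc c)} {k} blk c≤m = begin
    fromEnd proofSize (scaledFMMR i m) k
      ≡⟨ proofSize-earlier i j blk c≤m ⟩
    suc (fromEnd proofSize (scaledFMMR (suc i) (suc j)) (k ∸ 2 ^ i))
      ≡⟨ cong suc (proofSize-scaled b (suc i) (InBlock-shift blk) ⌊c/2⌋≤) ⟩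
    suc (suc i + y)
      ≡⟨ trans (+-suc i (suc y)) (cong suc (+-suc i y)) ⟨
    i + suc (1 + y)
      ≡⟨ cong (λ x → i + suc x) (proofSize-scaled b 1 (InBlock-shift self) ⌊c/2⌋≤) ⟨
    i + suc (fromEnd proofSize (scaledFMMR 1 (suc j)) (suc c))
      ≡⟨ cong (i +_) (proofSize-earlier 0 j self c≤m) ⟨
    i + fromEnd proofSize (fmmr m) (suc (suc c)) ∎
    where
    open ≡-Reasoning
    m = suc (double (suc j))
    y = fromEnd proofSize (fmmr (suc j)) ⌊ suc (suc c) /2⌋
    self = InBlock-self {suc (suc c)} (s≤s z≤n)
    ⌊c/2⌋≤ = m≤1+double[n]⇒⌊m/2⌋≤n (suc j) c≤m

  fromEnd-fmmr : ∀ f n c → 0 < n → f (fmmr n) (n ∸ c) ≡ fromEnd f (fmmr n) c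
  fromEnd-fmmr f n c 0<n =
    cong (λ s → f (fmmr n) (s ∸ c)) (sym (trans (size-scaledFMMR 0 (binary n) 0<n) (*-identityʳ n)))

  rFMMR-double : ∀ {c} j → 1 ≤ c → c ≤ double j → rFMMR c (double j) ≡ rFMMR ⌈ c /2⌉ j
  rFMMR-double {c} zero    1≤c c≤0 = contradiction (≤-trans 1≤c c≤0) λ ()
  rFMMR-double {c} (suc j) 1≤c c≤m = begin
    rFMMR c (double (suc j))
      ≡⟨ fromEnd-fmmr rangeAncestors (double (suc j)) c z<s ⟩
    fromEnd rangeAncestors (fmmr (double (suc j))) c
      ≡⟨ cong (λ t → fromEnd rangeAncestors t c) (scaledFMMR-double 0 (suc j)) ⟩
    fromEnd rangeAncestors (scaledFMMR 1 (suc j)) c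
      ≡⟨ rangeAncestors-scaled (binary (suc j)) 1 (InBlock-double (InBlock-self 1≤c))
           (m≤double[n]⇒⌈m/2⌉≤n (suc j) c≤m) ⟩
    fromEnd rangeAncestors (fmmr (suc j)) ⌈ c /2⌉
      ≡⟨ fromEnd-fmmr rangeAncestors (suc j) ⌈ c /2⌉ z<s ⟨
    rFMMR ⌈ c /2⌉ (suc j) ∎
    where open ≡-Reasoning

  rFMMR-suc-double : ∀ {c} j → 2 ≤ c → c ≤ suc (double j) →
    rFMMR c (suc (double j)) ≡ suc (rFMMR ⌊ c /2⌋ j)
  rFMMR-suc-double {suc (suc c)} zero    (s≤s (s≤s _)) (s≤s ())
  rFMMR-suc-double {suc (suc c)} (suc j) (s≤s (s≤s _)) c≤m = begin
    rFMMR (suc (suc c)) (suc (double (suc j)))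
      ≡⟨ fromEnd-fmmr rangeAncestors (suc (double (suc j))) (suc (suc c)) z<s ⟩
    fromEnd rangeAncestors (fmmr (suc (double (suc j)))) (suc (suc c))
      ≡⟨ rangeAncestors-earlier 0 j self c≤m ⟩
    suc (fromEnd rangeAncestors (scaledFMMR 1 (suc j)) (suc c))
      ≡⟨ cong suc (rangeAncestors-scaled (binary (suc j)) 1 (InBlock-shift self)
                    (m≤1+double[n]⇒⌊m/2⌋≤n (suc j) c≤m)) ⟩
    suc (fromEnd rangeAncestors (fmmr (suc j)) ⌊ suc (suc c) /2⌋)
      ≡⟨ cong suc (fromEnd-fmmr rangeAncestors (suc j) ⌊ suc (suc c) /2⌋ z<s) ⟨
    suc (rFMMR ⌊ suc (suc c) /2⌋ (suc j)) ∎
    where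
    open ≡-Reasoning
    self = InBlock-self {suc (suc c)} (s≤s z≤n)

  rFMMR-one-odd : ∀ j → rFMMR 1 (suc (double j)) ≡ 1
  rFMMR-one-odd j = trans (fromEnd-fmmr rangeAncestors (suc (double j)) 1 z<s) (rangeAncestors-last 0 j ≤-refl)

  rFMMR-one : ∀ {n} → Binary n → 0 < n → rFMMR 1 n ≡ 1
  rFMMR-one (even {j} b) _ = trans (rFMMR-double (suc j) ≤-refl (s≤s z≤n)) (rFMMR-one b z<s)
  rFMMR-one (odd {j} b)  _ = rFMMR-one-odd j

  σFMMR-double : ∀ {c} j → 1 ≤ c → c ≤ double j → σFMMR c (double j) ≡ 1 + σFMMR ⌈ c /2⌉ j
  σFMMR-double {c} zero    1≤c c≤0 = contradiction (≤-trans 1≤c c≤0) λ ()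
  σFMMR-double {c} (suc j) 1≤c c≤m = begin
    σFMMR c (double (suc j))
      ≡⟨ fromEnd-fmmr proofSize (double (suc j)) c z<s ⟩
    fromEnd proofSize (fmmr (double (suc j))) c
      ≡⟨ cong (λ t → fromEnd proofSize t c) (scaledFMMR-double 0 (suc j)) ⟩
    fromEnd proofSize (scaledFMMR 1 (suc j)) c
      ≡⟨ proofSize-scaled (binary (suc j)) 1 (InBlock-double (InBlock-self 1≤c))
           (m≤double[n]⇒⌈m/2⌉≤n (suc j) c≤m) ⟩
    1 + fromEnd proofSize (fmmr (suc j)) ⌈ c /2⌉
      ≡⟨ cong suc (fromEnd-fmmr proofSize (suc j) ⌈ c /2⌉ z<s) ⟨
    1 + σFMMR ⌈ c /2⌉ (suc j) ∎
    where open ≡-Reasoning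

  σFMMR-suc-double : ∀ {c} j → 2 ≤ c → c ≤ suc (double j) →
    σFMMR c (suc (double j)) ≡ 2 + σFMMR ⌊ c /2⌋ j
  σFMMR-suc-double {suc (suc c)} zero    (s≤s (s≤s _)) (s≤s ())
  σFMMR-suc-double {suc (suc c)} (suc j) (s≤s (s≤s _)) c≤m = begin
    σFMMR (suc (suc c)) (suc (double (suc j)))
      ≡⟨ fromEnd-fmmr proofSize (suc (double (suc j))) (suc (suc c)) z<s ⟩
    fromEnd proofSize (fmmr (suc (double (suc j)))) (suc (suc c))
      ≡⟨ proofSize-earlier 0 j self c≤m ⟩
    suc (fromEnd proofSize (scaledFMMR 1 (suc j)) (suc c))
      ≡⟨ cong suc (proofSize-scaled (binary (suc j)) 1 (InBlock-shift self)
                    (m≤1+double[n]⇒⌊m/2⌋≤n (suc j) c≤m)) ⟩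
    2 + fromEnd proofSize (fmmr (suc j)) ⌊ suc (suc c) /2⌋
      ≡⟨ cong (2 +_) (fromEnd-fmmr proofSize (suc j) ⌊ suc (suc c) /2⌋ z<s) ⟨
    2 + σFMMR ⌊ suc (suc c) /2⌋ (suc j) ∎
    where
    open ≡-Reasoning
    self = InBlock-self {suc (suc c)} (s≤s z≤n)

  σFMMR-one-odd : ∀ j → σFMMR 1 (suc (double j)) ≡ atLeast 1 j
  σFMMR-one-odd j = trans (fromEnd-fmmr proofSize (suc (double j)) 1 z<s) (proofSize-last 0 j ≤-refl)

module Slopes where

  open Halving
  open import Data.Nat
  open import Data.Nat.Properties
  open import Data.Nat.Logarithm
  open import Data.Nat.Induction using (<-rec)
  open import Data.Product using (_,_; ∃-syntax)
  open import Function using (_∘_)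
  open import Relation.Binary.PropositionalEquality
  open import Data.Nat.Tactic.RingSolver using (solve-∀)

  infix 4 _≈_±_
  record _≈_±_ (x y e : ℕ) : Set where
    constructor ±-intro
    field
      upper : x ≤ y + e
      lower : y ≤ x + e

  ≡⇒± : ∀ {x y} e → x ≡ y → x ≈ y ± e
  ≡⇒± {x} e refl = ±-intro (m≤m+n x e) (m≤m+n x e)

  +-≈ : ∀ x y → x + y ≈ y ± x
  +-≈ x y = ±-intro (≤-reflexive (+-comm x y)) (≤-trans (m≤n+m y x) (m≤m+n (x + y) x))

  ∸-≈ : ∀ x y → x ∸ y ≈ x ± y
  ∸-≈ x y = ±-intro
    (≤-trans (m∸n≤m x y) (m≤m+n x y))
    (≤-trans (m≤n+m∸n x y) (≤-reflexive (+-comm y (x ∸ y))))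

  ±-weaken : ∀ {x y e e′} → e ≤ e′ → x ≈ y ± e → x ≈ y ± e′
  ±-weaken {x} {y} e≤e′ (±-intro u l) =
    ±-intro (≤-trans u (+-monoʳ-≤ y e≤e′)) (≤-trans l (+-monoʳ-≤ x e≤e′))

  ±-trans : ∀ {x y z e e′} → x ≈ y ± e → y ≈ z ± e′ → x ≈ z ± e + e′
  ±-trans {x} {y} {z} {e} {e′} (±-intro u l) (±-intro u′ l′) = ±-intro
    (≤-trans u (≤-trans (+-monoˡ-≤ e u′) (≤-reflexive (trans (+-assoc z e′ e) (cong (z +_) (+-comm e′ e))))))
    (≤-trans l′ (≤-trans (+-monoˡ-≤ e′ l) (≤-reflexive (+-assoc x e e′))))

  ±-+ : ∀ {x y e x′ y′ e′} → x ≈ y ± e → x′ ≈ y′ ± e′ → x + x′ ≈ y + y′ ± e + e′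
  ±-+ {x} {y} {e} {x′} {y′} {e′} (±-intro u l) (±-intro u′ l′) = ±-intro
    (≤-trans (+-mono-≤ u u′) (≤-reflexive (arith y e y′ e′)))
    (≤-trans (+-mono-≤ l l′) (≤-reflexive (arith x e x′ e′)))
    where
    arith : ∀ a b c d → a + b + (c + d) ≡ a + c + (b + d)
    arith = solve-∀

  ±-*ˡ : ∀ n {x y e} → x ≈ y ± e → n * x ≈ n * y ± n * e
  ±-*ˡ n {x} {y} {e} (±-intro u l) = ±-intro
    (≤-trans (*-monoʳ-≤ n u) (≤-reflexive (*-distribˡ-+ n y e)))
    (≤-trans (*-monoʳ-≤ n l) (≤-reflexive (*-distribˡ-+ n x e)))

  ±-sandwich : ∀ {x₀ x x₁ y₀ y y₁ e₀ e₁ d} → x₀ ≤ x → x ≤ x₁ →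
    x₀ ≈ y₀ ± e₀ → x₁ ≈ y₁ ± e₁ → y ≤ y₀ + d → y₁ ≤ y + d → x ≈ y ± (e₀ ⊔ e₁) + d
  ±-sandwich {x₀} {x} {x₁} {y₀} {y} {y₁} {e₀} {e₁} {d} x₀≤x x≤x₁ (±-intro _ l₀) (±-intro u₁ _) y≤ y₁≤ =
    ±-intro upper lower
    where
    open ≤-Reasoning
    upper : x ≤ y + ((e₀ ⊔ e₁) + d)
    upper = begin
      x                    ≤⟨ ≤-trans x≤x₁ u₁ ⟩
      y₁ + e₁              ≤⟨ +-mono-≤ y₁≤ (m≤n⊔m e₀ e₁) ⟩
      y + d + (e₀ ⊔ e₁)    ≡⟨ trans (+-assoc y d _) (cong (y +_) (+-comm d _)) ⟩
      y + ((e₀ ⊔ e₁) + d)  ∎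
    lower : y ≤ x + ((e₀ ⊔ e₁) + d)
    lower = begin
      y                    ≤⟨ y≤ ⟩
      y₀ + d               ≤⟨ +-monoˡ-≤ d l₀ ⟩
      x₀ + e₀ + d          ≤⟨ +-monoˡ-≤ d (+-mono-≤ x₀≤x (m≤m⊔n e₀ e₁)) ⟩
      x + (e₀ ⊔ e₁) + d    ≡⟨ +-assoc x _ d ⟩
      x + ((e₀ ⊔ e₁) + d)  ∎

  record HasSlope (F : ℕ → ℕ) (a b : ℕ) (e : ℕ → ℕ) : Set where
    constructor hasSlope
    field
      ≈-at : ∀ T → b * F T ≈ a * T ± e T
  open HasSlope public

  HasSlope-cong : ∀ {F G a b e} → (∀ T → F T ≡ G T) → HasSlope F a b e → HasSlope G a b e
  HasSlope-cong {a = a} {b} {e} F≡G slope =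
    hasSlope λ T → subst (λ x → b * x ≈ a * T ± e T) (F≡G T) (≈-at slope T)

  HasSlope-numerator : ∀ {F a a′ b e} → a ≡ a′ → HasSlope F a b e → HasSlope F a′ b e
  HasSlope-numerator refl slope = slope

  HasSlope-+ : ∀ {F G a a′ b e e′} → HasSlope F a b e → HasSlope G a′ b e′ →
    HasSlope (λ T → F T + G T) (a + a′) b (λ T → e T + e′ T)
  HasSlope-+ {F} {G} {a} {a′} {b} {e} {e′} slopeF slopeG = hasSlope λ T →
    subst₂ (λ x y → x ≈ y ± e T + e′ T) (sym (*-distribˡ-+ b (F T) (G T))) (sym (*-distribʳ-+ T a a′))
      (±-+ (≈-at slopeF T) (≈-at slopeG T))

  HasSlope-scale : ∀ n {F a b e} → HasSlope F a b e → HasSlope F (n * a) (n * b) (λ T → n * e T)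
  HasSlope-scale n {F} {a} {b} {e} slope = hasSlope λ T → subst₂ (λ x y → x ≈ y ± n * e T)
    (sym (*-assoc n b (F T))) (sym (*-assoc n a T)) (±-*ˡ n (≈-at slope T))

  HasSlope-*∸ : ∀ α b c → HasSlope (λ T → α * (T ∸ c)) (b * α) b (λ _ → b * α * c)
  HasSlope-*∸ α b c = hasSlope λ T →
    subst (λ x → x ≈ b * α * T ± b * α * c) (*-assoc b α (T ∸ c)) (±-*ˡ (b * α) (∸-≈ T c))

  HasSlope-shift : ∀ k {F a b e} → HasSlope F a b e →
    HasSlope (λ N → F (k + N)) a b (λ N → e (k + N) + a * k)
  HasSlope-shift k {a = a} slope = hasSlope λ N → ±-trans (≈-at slope (k + N))
    (subst (λ y → y ≈ a * N ± a * k) (sym (*-distribˡ-+ a k N)) (+-≈ (a * k) (a * N)))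

  interpolationError : (ℕ → ℕ) → ℕ → ℕ → ℕ
  interpolationError e a T = 2 * (e ⌊ T /2⌋ + e (suc ⌊ T /2⌋)) + a

  HasSlope-interpolate : ∀ {F a b e} → (∀ T → F T ≤ F (suc T)) → HasSlope (F ∘ double) a b e →
    HasSlope F a (2 * b) (interpolationError e a)
  HasSlope-interpolate {F} {a} {b} {e} mono slope = hasSlope λ T → at (binary T)
    where
    at-double : ∀ j → 2 * b * F (double j) ≈ a * double j ± 2 * e j
    at-double j = subst₂ (λ x y → x ≈ y ± 2 * e j)
      (sym (*-assoc 2 b _))
      (trans (*-comm 2 (a * j)) (trans (*-assoc a j 2) (cong (a *_) (trans (*-comm j 2) (sym (double≡2* j))))))
      (±-*ˡ 2 (≈-at slope j))
    at-even : ∀ j → 2 * b * F (double j) ≈ a * double j ± interpolationError e a (double j)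
    at-even j rewrite ⌊double[n]/2⌋≡n j =
      ±-weaken (≤-trans (*-monoʳ-≤ 2 (m≤m+n (e j) _)) (m≤m+n _ a)) (at-double j)
    at : ∀ {T} → Binary T → 2 * b * F T ≈ a * T ± interpolationError e a T
    at zero           = at-even 0
    at (even {j} _)   = at-even (suc j)
    at (odd {j} _)    =
      subst (λ i → 2 * b * F (suc (double j)) ≈ a * suc (double j) ± 2 * (e i + e (suc i)) + a)
        (sym (⌊1+double[n]/2⌋≡n j))
      (±-weaken (+-monoˡ-≤ a (≤-trans (m⊔n≤m+n (2 * e j) (2 * e (suc j)))
                                      (≤-reflexive (sym (*-distribˡ-+ 2 (e j) (e (suc j)))))))
        (±-sandwich (*-monoʳ-≤ (2 * b) (mono (double j))) (*-monoʳ-≤ (2 * b) (mono (suc (double j))))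
          (at-double j) (at-double (suc j))
          (≤-reflexive (trans (*-suc a (double j)) (+-comm a _)))
          (≤-reflexive (trans (*-suc a (suc (double j))) (+-comm a _)))))

  Sublinear : (ℕ → ℕ) → Set
  Sublinear e = ∀ K → ∃[ M ] (∀ T → M ≤ T → K * e T ≤ T)

  Sublinear-const : ∀ c → Sublinear (λ _ → c)
  Sublinear-const c K = K * c , λ _ Kc≤T → Kc≤T

  Sublinear-+ : ∀ {e e′} → Sublinear e → Sublinear e′ → Sublinear (λ T → e T + e′ T)
  Sublinear-+ {e} {e′} sub sub′ K with sub (2 * K) | sub′ (2 * K)
  ... | M , small | M′ , small′ = M ⊔ M′ , λ T M⊔M′≤T → *-cancelˡ-≤ 2 (begin
    2 * (K * (e T + e′ T))      ≡⟨ arith K (e T) (e′ T) ⟩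
    2 * K * e T + 2 * K * e′ T  ≤⟨ +-mono-≤ (small T (≤-trans (m≤m⊔n M M′) M⊔M′≤T))
                                            (small′ T (≤-trans (m≤n⊔m M M′) M⊔M′≤T)) ⟩
    T + T                       ≡⟨ cong (T +_) (+-identityʳ T) ⟨
    2 * T                       ∎)
    where
    open ≤-Reasoning
    arith : ∀ K x y → 2 * (K * (x + y)) ≡ 2 * K * x + 2 * K * y
    arith = solve-∀

  Sublinear-*ˡ : ∀ n {e} → Sublinear e → Sublinear (λ T → n * e T)
  Sublinear-*ˡ n {e} sub K with sub (K * n)
  ... | M , small = M , λ T M≤T → ≤-trans (≤-reflexive (sym (*-assoc K n (e T)))) (small T M≤T)

  Sublinear-∘⌊/2⌋ : ∀ {e} → Sublinear e → Sublinear (λ T → e ⌊ T /2⌋)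
  Sublinear-∘⌊/2⌋ {e} sub K with sub K
  ... | M , small = double M , λ T 2M≤T →
    ≤-trans (small ⌊ T /2⌋ (subst (_≤ ⌊ T /2⌋) (⌊double[n]/2⌋≡n M) (⌊n/2⌋-mono 2M≤T))) (⌊n/2⌋≤n T)

  Sublinear-∘+ : ∀ k {e} → Sublinear e → Sublinear (λ T → e (k + T))
  Sublinear-∘+ k {e} sub K with sub (2 * K)
  ... | M , small = M ⊔ k , λ T M⊔k≤T → *-cancelˡ-≤ 2 (begin
    2 * (K * e (k + T))  ≡⟨ *-assoc 2 K _ ⟨
    2 * K * e (k + T)    ≤⟨ small (k + T) (≤-trans (m≤m⊔n M k) (≤-trans M⊔k≤T (m≤n+m T k))) ⟩
    k + T                ≤⟨ +-monoˡ-≤ T (≤-trans (m≤n⊔m M k) M⊔k≤T) ⟩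
    T + T                ≡⟨ cong (T +_) (+-identityʳ T) ⟨
    2 * T                ∎)
    where open ≤-Reasoning

  Sublinear-interpolate : ∀ {e} a → Sublinear e → Sublinear (interpolationError e a)
  Sublinear-interpolate a sub = Sublinear-+
    (Sublinear-*ˡ 2 (Sublinear-+ (Sublinear-∘⌊/2⌋ sub) (Sublinear-∘⌊/2⌋ (Sublinear-∘+ 1 sub))))
    (Sublinear-const a)

  n<2^n : ∀ n → n < 2 ^ n
  n<2^n zero    = s≤s z≤n
  n<2^n (suc n) = ≤-trans (s≤s (n<2^n n))
    (≤-trans (≤-reflexive (+-comm 1 (2 ^ n))) (+-monoʳ-≤ (2 ^ n) (≤-trans (m^n>0 2 n) (m≤m+n (2 ^ n) 0))))

  *-≤-2^ : ∀ K i → K * (4 * K + i) ≤ 2 ^ (4 * K + i)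
  *-≤-2^ K zero = begin
    K * (4 * K + 0)            ≡⟨ arith K ⟩
    2 * K * (2 * K)            ≤⟨ *-mono-≤ (<⇒≤ (n<2^n (2 * K))) (<⇒≤ (n<2^n (2 * K))) ⟩
    2 ^ (2 * K) * 2 ^ (2 * K)  ≡⟨ ^-distribˡ-+-* 2 (2 * K) (2 * K) ⟨
    2 ^ (2 * K + 2 * K)        ≡⟨ cong (2 ^_) (arith′ K) ⟩
    2 ^ (4 * K + 0)            ∎
    where
    open ≤-Reasoning
    arith : ∀ K → K * (4 * K + 0) ≡ 2 * K * (2 * K)
    arith = solve-∀
    arith′ : ∀ K → 2 * K + 2 * K ≡ 4 * K + 0
    arith′ = solve-∀
  *-≤-2^ K (suc i) = begin
    K * (4 * K + suc i)        ≡⟨ trans (cong (K *_) (+-suc (4 * K) i)) (*-suc K _) ⟩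
    K + K * (4 * K + i)        ≤⟨ +-mono-≤ K≤2^ (*-≤-2^ K i) ⟩
    2 ^ (4 * K + i) + 2 ^ (4 * K + i) ≡⟨ cong (2 ^ (4 * K + i) +_) (+-identityʳ _) ⟨
    2 ^ suc (4 * K + i)        ≡⟨ cong (2 ^_) (+-suc (4 * K) i) ⟨
    2 ^ (4 * K + suc i)        ∎
    where
    open ≤-Reasoning
    K≤2^ : K ≤ 2 ^ (4 * K + i)
    K≤2^ = ≤-trans (≤-trans (m≤n*m K 4) (m≤m+n (4 * K) i)) (<⇒≤ (n<2^n _))

  Sublinear-⌈log₂⌉ : Sublinear ⌈log₂_⌉
  -- Beyond T = 2 ^ L, D = ⌈log₂ T⌉ ≥ L = 8K and so 2K·D ≤ 2 ^ D ≤ 2T.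
  Sublinear-⌈log₂⌉ K = 2 ^ L , λ T 2^L≤T → *-cancelˡ-≤ 2 (bound T 2^L≤T)
    where
    L = 4 * (2 * K)
    bound : ∀ T → 2 ^ L ≤ T → 2 * (K * ⌈log₂ T ⌉) ≤ 2 * T
    bound T 2^L≤T = begin
      2 * (K * D)               ≡⟨ *-assoc 2 K D ⟨
      2 * K * D                 ≡⟨ cong (2 * K *_) (m+[n∸m]≡n L≤D) ⟨
      2 * K * (L + (D ∸ L))     ≤⟨ *-≤-2^ (2 * K) (D ∸ L) ⟩
      2 ^ (L + (D ∸ L))         ≡⟨ cong (2 ^_) (m+[n∸m]≡n L≤D) ⟩
      2 ^ D                     ≤⟨ LogBracket.above (⌈log₂⌉-bracket (≤-trans (m^n>0 2 L) 2^L≤T)) ⟩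
      2 * T                     ∎
      where
      open ≤-Reasoning
      D = ⌈log₂ T ⌉
      L≤D : L ≤ D
      L≤D = subst (_≤ D) (⌈log₂2^n⌉≡n L) (⌈log₂⌉-mono-≤ 2^L≤T)

  logError : ℕ → ℕ → ℕ
  logError c T = c * suc ⌈log₂ T ⌉

  Sublinear-logError : ∀ c → Sublinear (logError c)
  Sublinear-logError c = Sublinear-*ˡ c (Sublinear-+ (Sublinear-const 1) Sublinear-⌈log₂⌉)

  logError-mono : ∀ c {S T} → S ≤ T → logError c S ≤ logError c T
  logError-mono c S≤T = *-monoʳ-≤ c (s≤s (⌈log₂⌉-mono-≤ S≤T))

  logError-⌈/2⌉ : ∀ c n → 2 ≤ n → logError c ⌈ n /2⌉ + c ≡ logError c n
  logError-⌈/2⌉ c n 2≤n =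
    trans (trans (+-comm _ c) (sym (*-suc c _))) (cong (λ L → c * suc L) (⌈log₂⌉-⌈/2⌉ 2≤n))

  -- From F (2T) = F T + X T with X T ≈ u T the error of F T ≈ u T grows by a constant at each
  -- halving of T, hence only logarithmically.
  module _ {F X : ℕ → ℕ} {u w : ℕ}
           (F-double : ∀ T → F (double T) ≡ F T + X T)
           (F-mono : ∀ T → F T ≤ F (suc T))
           (F-zero : F 0 ≡ 0) (F-one : F 1 ≡ 0)
           (X-≈ : ∀ T → X T ≈ u * T ± w) where

    private
      E : ℕ → ℕ
      E = logError (u + w)

      F-double-≈ : ∀ {S e} → F S ≈ u * S ± e → F (double S) ≈ u * double S ± e + w
      F-double-≈ {S} {e} F≈ = subst₂ (λ x y → x ≈ y ± e + w) (sym (F-double S)) u*2S (±-+ F≈ (X-≈ S))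
        where
        u*2S : u * S + u * S ≡ u * double S
        u*2S = trans (sym (*-distribˡ-+ u S S))
          (cong (u *_) (trans (cong (S +_) (sym (+-identityʳ S))) (sym (double≡2* S))))

      E-double : ∀ j → E (suc j) + w ≤ E (double (suc j))
      E-double j = ≤-trans (+-monoʳ-≤ (E (suc j)) (m≤n+m w u))
        (≤-reflexive (trans (cong (λ n → E n + (u + w)) (sym (⌈double[n]/2⌉≡n (suc j))))
                            (logError-⌈/2⌉ (u + w) (double (suc j)) (s≤s (s≤s z≤n)))))

      E-odd : ∀ j → (E (suc j) + w) ⊔ (E (suc (suc j)) + w) + u ≤ E (suc (double (suc j)))
      E-odd j = begin
        (E (suc j) + w) ⊔ (E (suc (suc j)) + w) + u
          ≤⟨ +-monoˡ-≤ u (⊔-lub (+-monoˡ-≤ w (logError-mono (u + w) (n≤1+n (suc j)))) ≤-refl) ⟩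
        E (suc (suc j)) + w + u
          ≡⟨ trans (+-assoc _ w u) (cong (E (suc (suc j)) +_) (+-comm w u)) ⟩
        E (suc (suc j)) + (u + w)
          ≡⟨ cong (λ n → E n + (u + w)) (⌈1+double[n]/2⌉≡1+n (suc j)) ⟨
        E ⌈ suc (double (suc j)) /2⌉ + (u + w)
          ≡⟨ logError-⌈/2⌉ (u + w) (suc (double (suc j))) (s≤s (s≤s z≤n)) ⟩
        E (suc (double (suc j))) ∎
        where open ≤-Reasoning

      step : ∀ T → (∀ {S} → S < T → F S ≈ u * S ± E S) → F T ≈ u * T ± E T
      step T rec with binary T
      ... | zero            = ≡⇒± (E 0) (trans F-zero (sym (*-zeroʳ u)))
      ... | odd {zero} zero = subst (λ x → x ≈ u * 1 ± E 1) (sym F-one)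
        (±-intro z≤n (≤-trans (*-monoˡ-≤ 1 (m≤m+n u w)) (m≤n+m _ 0)))
      ... | even {j} _      = ±-weaken (E-double j) (F-double-≈ (rec (s≤s (s≤s (n≤double[n] j)))))
      ... | odd {suc j} _   = ±-weaken (E-odd j)
        (±-sandwich (F-mono _) (F-mono _)
          (F-double-≈ (rec (s≤s (s≤s (≤-trans (n≤double[n] j) (n≤1+n _))))))
          (F-double-≈ (rec (s≤s (s≤s (s≤s (n≤double[n] j))))))
          (≤-reflexive (trans (*-suc u _) (+-comm u _)))
          (≤-reflexive (trans (*-suc u _) (+-comm u _))))

    HasSlope-self-similar : HasSlope F u 1 (logError (u + w))
    HasSlope-self-similar = hasSlope λ T →
      subst (λ x → x ≈ u * T ± E T) (sym (*-identityˡ (F T))) (<-rec _ step T)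

module Amortization where

  open Halving
  open ScaledFMMR
  open Slopes
  open import Data.Nat
  open import Data.Nat.Properties
  open import Data.Product using (_×_; _,_; ∃-syntax)
  open import Function using (_∘_)
  open import Relation.Nullary using (contradiction)
  open import Relation.Binary.PropositionalEquality
  open import Data.Nat.Tactic.RingSolver using (solve-∀)

  sumBelow : (ℕ → ℕ) → ℕ → ℕ
  sumBelow u zero    = 0
  sumBelow u (suc T) = sumBelow u T + u T

  sumBelow-cong : ∀ {u v} T → (∀ n → u n ≡ v n) → sumBelow u T ≡ sumBelow v T
  sumBelow-cong zero    _   = refl
  sumBelow-cong (suc T) u≡v = cong₂ _+_ (sumBelow-cong T u≡v) (u≡v T)

  sumBelow-+ : ∀ u v T → sumBelow (λ n → u n + v n) T ≡ sumBelow u T + sumBelow v T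
  sumBelow-+ u v zero    = refl
  sumBelow-+ u v (suc T) = trans (cong (_+ (u T + v T)) (sumBelow-+ u v T))
    (arith (sumBelow u T) (sumBelow v T) (u T) (v T))
    where
    arith : ∀ a b c d → a + b + (c + d) ≡ a + c + (b + d)
    arith = solve-∀

  sumBelow-*ˡ : ∀ a u T → sumBelow (λ n → a * u n) T ≡ a * sumBelow u T
  sumBelow-*ˡ a u zero    = sym (*-zeroʳ a)
  sumBelow-*ˡ a u (suc T) = trans (cong (_+ a * u T) (sumBelow-*ˡ a u T)) (sym (*-distribˡ-+ a _ (u T)))

  sumBelow-double : ∀ u T → sumBelow u (double T) ≡ sumBelow (u ∘ double) T + sumBelow (u ∘ suc ∘ double) T
  sumBelow-double u zero    = refl
  sumBelow-double u (suc T) = trans (cong (λ s → s + u (double T) + u (suc (double T))) (sumBelow-double u T))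
    (arith (sumBelow (u ∘ double) T) (sumBelow (u ∘ suc ∘ double) T) (u (double T)) (u (suc (double T))))
    where
    arith : ∀ a b c d → a + b + c + d ≡ a + c + (b + d)
    arith = solve-∀

  sumBelow-atLeast : ∀ c T → sumBelow (atLeast c) T ≡ T ∸ c
  sumBelow-atLeast c       zero    = sym (0∸n≡0 c)
  sumBelow-atLeast c       (suc T) = trans (cong (_+ atLeast c T) (sumBelow-atLeast c T)) (atLeast-+-∸ c T)

  cumulative : (ℕ → ℕ → ℕ) → ℕ → ℕ → ℕ
  cumulative f c = sumBelow (λ n → atLeast c n * f c n)

  cumulative-≤ : ∀ f c T → T ≤ c → cumulative f c T ≡ 0
  cumulative-≤ f c zero    _   = refl
  cumulative-≤ f c (suc T) T<c = cong₂ _+_ (cumulative-≤ f c T (<⇒≤ T<c)) (cong (_* f c T) (atLeast-< T<c))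

  cumulative-mono : ∀ f c T → cumulative f c T ≤ cumulative f c (suc T)
  cumulative-mono f c T = m≤m+n _ _

  windowSum≡cumulative : ∀ f k N → windowSum f k N ≡ cumulative f k (k + N)
  windowSum≡cumulative f k zero    = sym (cumulative-≤ f k (k + 0) (≤-reflexive (+-identityʳ k)))
  windowSum≡cumulative f k (suc N) = begin
    windowSum f k N + f k (k + N)
      ≡⟨ cong₂ _+_ (windowSum≡cumulative f k N) (sym (*-identityˡ _)) ⟩
    cumulative f k (k + N) + 1 * f k (k + N)
      ≡⟨ cong (λ a → cumulative f k (k + N) + a * f k (k + N)) (atLeast-+ k N) ⟨
    cumulative f k (suc (k + N))
      ≡⟨ cong (cumulative f k) (+-suc k N) ⟨
    cumulative f k (k + suc N) ∎
    where open ≡-Reasoning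

  record HalvingRecurrence (f : ℕ → ℕ → ℕ) (α β : ℕ) : Set where
    field
      at-double     : ∀ {c} j → 1 ≤ c → c ≤ double j → f c (double j) ≡ α + f ⌈ c /2⌉ j
      at-suc-double : ∀ {c} j → 2 ≤ c → c ≤ suc (double j) → f c (suc (double j)) ≡ β + f ⌊ c /2⌋ j

  sumBelow-subsequence : ∀ f {c c′} α (g : ℕ → ℕ) T →
    (∀ j → atLeast c (g j) ≡ atLeast c′ j) → (∀ j → c ≤ g j → f c (g j) ≡ α + f c′ j) →
    sumBelow (λ j → atLeast c (g j) * f c (g j)) T ≡ α * (T ∸ c′) + cumulative f c′ T
  sumBelow-subsequence f {c} {c′} α g T atLeast≡ f≡ = begin
    sumBelow (λ j → atLeast c (g j) * f c (g j)) T
      ≡⟨ sumBelow-cong T term ⟩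
    sumBelow (λ j → α * atLeast c′ j + atLeast c′ j * f c′ j) T
      ≡⟨ sumBelow-+ (λ j → α * atLeast c′ j) (λ j → atLeast c′ j * f c′ j) T ⟩
    sumBelow (λ j → α * atLeast c′ j) T + cumulative f c′ T
      ≡⟨ cong (_+ cumulative f c′ T)
           (trans (sumBelow-*ˡ α (atLeast c′) T) (cong (α *_) (sumBelow-atLeast c′ T))) ⟩
    α * (T ∸ c′) + cumulative f c′ T ∎
    where
    open ≡-Reasoning
    arith : ∀ a x y → a * (x + y) ≡ x * a + a * y
    arith = solve-∀
    term : ∀ j → atLeast c (g j) * f c (g j) ≡ α * atLeast c′ j + atLeast c′ j * f c′ j
    term j = begin
      atLeast c (g j) * f c (g j)    ≡⟨ atLeast-*-cong c (g j) (f≡ j) ⟩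
      atLeast c (g j) * (α + f c′ j) ≡⟨ cong (_* (α + f c′ j)) (atLeast≡ j) ⟩
      atLeast c′ j * (α + f c′ j)    ≡⟨ arith (atLeast c′ j) α (f c′ j) ⟩
      α * atLeast c′ j + atLeast c′ j * f c′ j ∎

  cumulative-double : ∀ {f α β} → HalvingRecurrence f α β → ∀ {c} → 2 ≤ c → ∀ T →
    cumulative f c (double T)
      ≡ (α * (T ∸ ⌈ c /2⌉) + cumulative f ⌈ c /2⌉ T) + (β * (T ∸ ⌊ c /2⌋) + cumulative f ⌊ c /2⌋ T)
  cumulative-double {f} {α} {β} rec {c} 2≤c T = trans (sumBelow-double (λ n → atLeast c n * f c n) T)
    (cong₂ _+_
      (sumBelow-subsequence f α double T (atLeast-double c) (λ j → at-double j (≤-trans (s≤s z≤n) 2≤c)))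
      (sumBelow-subsequence f β (suc ∘ double) T (atLeast-suc-double c) (λ j → at-suc-double j 2≤c)))
    where open HalvingRecurrence rec

  module _ {f α β} (rec : HalvingRecurrence f α β)
           {e₁} (e₁-sublinear : Sublinear e₁) (slope₁ : HasSlope (cumulative f 1) (α + β) 1 e₁) where

    -- 2 ^ (D + 1) times the amortized value (α + β)(D / 2 + c / 2 ^ D).
    amortizedNumerator : ℕ → ℕ → ℕ
    amortizedNumerator D c = (α + β) * (D * 2 ^ D + 2 * c)

    amortizedNumerator-halves : ∀ D c →
      2 ^ suc D * α + amortizedNumerator D ⌈ c /2⌉ + (2 ^ suc D * β + amortizedNumerator D ⌊ c /2⌋)
        ≡ amortizedNumerator (suc D) c
    amortizedNumerator-halves D c = trans (arith α β D (2 ^ D) ⌈ c /2⌉ ⌊ c /2⌋)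
      (cong (λ x → (α + β) * (suc D * 2 ^ suc D + 2 * x)) (⌊n/2⌋+⌈n/2⌉≡n c))
      where
      arith : ∀ α β D P x y → 2 * P * α + (α + β) * (D * P + 2 * x) + (2 * P * β + (α + β) * (D * P + 2 * y))
                            ≡ (α + β) * (suc D * (2 * P) + 2 * (y + x))
      arith = solve-∀

    cumulative-slope : ∀ D {c} → LogBracket D c →
      ∃[ e ] Sublinear e × HasSlope (cumulative f c) (amortizedNumerator D c) (2 ^ suc D) e
    cumulative-slope D {zero} br = contradiction (LogBracket.pos br) λ ()
    cumulative-slope zero {suc zero} _ =
      _ , Sublinear-*ˡ 2 e₁-sublinear , HasSlope-numerator (*-comm 2 (α + β)) (HasSlope-scale 2 slope₁)
    cumulative-slope zero {suc (suc c)} br = contradiction (LogBracket.below br) λ { (s≤s ()) }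
    cumulative-slope (suc zero) {suc zero} _ =
      _ , Sublinear-*ˡ 4 e₁-sublinear , HasSlope-numerator (*-comm 4 (α + β)) (HasSlope-scale 4 slope₁)
    cumulative-slope (suc (suc D)) {suc zero} br = contradiction (LogBracket.above br) (<⇒≱ 2<2^D+2)
      where
      2<2^D+2 : 2 < 2 ^ suc (suc D)
      2<2^D+2 = ≤-trans (n≤1+n 3) (*-monoʳ-≤ 2 (*-monoʳ-≤ 2 (m^n>0 2 D)))
    cumulative-slope (suc D) {c@(suc (suc _))} br
      with cumulative-slope D (LogBracket-⌈/2⌉ (s≤s (s≤s z≤n)) br)
         | cumulative-slope D (LogBracket-⌊/2⌋ (s≤s (s≤s z≤n)) br)
    ... | e⌈⌉ , sub⌈⌉ , slope⌈⌉ | e⌊⌋ , sub⌊⌋ , slope⌊⌋ =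
      interpolationError E a , Sublinear-interpolate a sub-E ,
      HasSlope-numerator (amortizedNumerator-halves D c) (HasSlope-interpolate (cumulative-mono f c) slope-at-double)
      where
      b = 2 ^ suc D
      a = b * α + amortizedNumerator D ⌈ c /2⌉ + (b * β + amortizedNumerator D ⌊ c /2⌋)
      E : ℕ → ℕ
      E T = (b * α * ⌈ c /2⌉ + e⌈⌉ T) + (b * β * ⌊ c /2⌋ + e⌊⌋ T)
      sub-E : Sublinear E
      sub-E = Sublinear-+ (Sublinear-+ (Sublinear-const (b * α * ⌈ c /2⌉)) sub⌈⌉)
                          (Sublinear-+ (Sublinear-const (b * β * ⌊ c /2⌋)) sub⌊⌋)
      slope-at-double : HasSlope (cumulative f c ∘ double) a b E
      slope-at-double = HasSlope-cong (λ T → sym (cumulative-double rec (s≤s (s≤s z≤n)) T))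
        (HasSlope-+ (HasSlope-+ (HasSlope-*∸ α b ⌈ c /2⌉) slope⌈⌉)
                    (HasSlope-+ (HasSlope-*∸ β b ⌊ c /2⌋) slope⌊⌋))

  rFMMR-halving : HalvingRecurrence rFMMR 0 1
  rFMMR-halving = record { at-double = rFMMR-double ; at-suc-double = rFMMR-suc-double }

  cumulative-rFMMR-one : ∀ T → cumulative rFMMR 1 T ≡ T ∸ 1
  cumulative-rFMMR-one T = trans (sumBelow-cong T newest) (sumBelow-atLeast 1 T)
    where
    newest : ∀ n → atLeast 1 n * rFMMR 1 n ≡ atLeast 1 n
    newest n = trans (atLeast-*-cong 1 n (rFMMR-one (binary n))) (*-identityʳ _)

  rFMMR-slope-one : HasSlope (cumulative rFMMR 1) 1 1 (λ _ → 1)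
  rFMMR-slope-one =
    HasSlope-cong (λ T → trans (*-identityˡ _) (sym (cumulative-rFMMR-one T))) (HasSlope-*∸ 1 1 1)

  -- σ + 1 has the same increments as σ, but its slope 3 at k = 1 equals α + β, as required by
  -- cumulative-slope.
  σFMMR+1 : ℕ → ℕ → ℕ
  σFMMR+1 c n = suc (σFMMR c n)

  σFMMR+1-halving : HalvingRecurrence σFMMR+1 1 2
  σFMMR+1-halving = record
    { at-double     = λ j 1≤c c≤2j → cong suc (σFMMR-double j 1≤c c≤2j)
    ; at-suc-double = λ j 2≤c c≤2j+1 → cong suc (σFMMR-suc-double j 2≤c c≤2j+1)
    }

  cumulative-σFMMR+1-double : ∀ T →
    cumulative σFMMR+1 1 (double T) ≡ cumulative σFMMR+1 1 T + ((T ∸ 1) + (T + (T ∸ 1)))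
  cumulative-σFMMR+1-double T = begin
    cumulative σFMMR+1 1 (double T)
      ≡⟨ sumBelow-double (λ n → atLeast 1 n * σFMMR+1 1 n) T ⟩
    sumBelow (λ j → atLeast 1 (double j) * σFMMR+1 1 (double j)) T
      + sumBelow (λ j → 1 * σFMMR+1 1 (suc (double j))) T
      ≡⟨ cong₂ _+_ (sumBelow-subsequence σFMMR+1 {1} {1} 1 double T (atLeast-double 1)
                     (λ j 1≤2j → cong suc (σFMMR-double j ≤-refl 1≤2j)))
                   (trans (sumBelow-cong T last) (trans (sumBelow-+ (atLeast 0) (atLeast 1) T)
                     (cong₂ _+_ (sumBelow-atLeast 0 T) (sumBelow-atLeast 1 T)))) ⟩
    1 * (T ∸ 1) + cumulative σFMMR+1 1 T + (T + (T ∸ 1))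
      ≡⟨ arith (T ∸ 1) (cumulative σFMMR+1 1 T) T ⟩
    cumulative σFMMR+1 1 T + ((T ∸ 1) + (T + (T ∸ 1))) ∎
    where
    open ≡-Reasoning
    last : ∀ j → 1 * σFMMR+1 1 (suc (double j)) ≡ atLeast 0 j + atLeast 1 j
    last j = trans (*-identityˡ _) (cong suc (σFMMR-one-odd j))
    arith : ∀ x C T → 1 * x + C + (T + x) ≡ C + (x + (T + x))
    arith = solve-∀

  σFMMR+1-slope-one : HasSlope (cumulative σFMMR+1 1) 3 1 (logError 5)
  σFMMR+1-slope-one = HasSlope-self-similar cumulative-σFMMR+1-double (cumulative-mono σFMMR+1 1) refl refl X≈
    where
    X≈ : ∀ T → (T ∸ 1) + (T + (T ∸ 1)) ≈ 3 * T ± 2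
    X≈ T = subst (λ y → (T ∸ 1) + (T + (T ∸ 1)) ≈ y ± 2)
      (cong (λ x → T + (T + x)) (sym (+-identityʳ T)))
      (±-+ (∸-≈ T 1) (±-+ (≡⇒± 0 refl) (∸-≈ T 1)))


module Limits where

  open Halving using (⌈log₂⌉-bracket)
  open Slopes
  open Amortization
  open import Data.Nat.Base as ℕ using (ℕ; zero; suc; z≤n; s≤s; NonZero)
  import Data.Nat.Properties as ℕ
  open import Data.Nat.Logarithm using (⌈log₂_⌉)
  open import Data.Integer.Base as ℤ using (+_; +[1+_]; -[1+_]; +<+; _⊖_)
  import Data.Integer.Properties as ℤ
  open import Data.Rational.Base using (mkℚ; toℚᵘ; *<*; 1ℚ; _+_; _-_; -_; _*_; ∣_∣; _<_) renaming (_/_ to _÷_)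
  import Data.Rational.Properties as ℚ
  open import Data.Rational.Solver using (module +-*-Solver)
  open import Data.Rational.Unnormalised.Base as ℚᵘ using (mkℚᵘ; *≡*) renaming (_/_ to _÷ᵘ_)
  import Data.Rational.Unnormalised.Properties as ℚᵘ
  open import Data.Product using (_,_; proj₁; proj₂)
  open import Data.Sum using (inj₁; inj₂)
  open import Relation.Binary.PropositionalEquality
  open import Data.Nat.Tactic.RingSolver using (solve-∀)

  toℚᵘ-÷ : ∀ a b .{{_ : NonZero b}} → toℚᵘ ((+ a) ÷ b) ℚᵘ.≃ (+ a) ÷ᵘ b
  toℚᵘ-÷ a (suc b) = ℚ.toℚᵘ-fromℚᵘ (mkℚᵘ (+ a) b)

  ÷-cross : ∀ a b c d .{{_ : NonZero b}} .{{_ : NonZero d}} → a ℕ.* d ≡ c ℕ.* b → (+ a) ÷ b ≡ (+ c) ÷ d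
  ÷-cross a (suc b) c (suc d) eq = ℚ.fromℚᵘ-cong {mkℚᵘ (+ a) b} {mkℚᵘ (+ c) d}
    (*≡* (trans (sym (ℤ.pos-* a (suc d))) (trans (cong +_ eq) (ℤ.pos-* c (suc b)))))

  ÷-+ : ∀ a b c d .{{_ : NonZero b}} .{{_ : NonZero d}} →
    (+ a) ÷ b + (+ c) ÷ d ≡ _÷_ (+ (a ℕ.* d ℕ.+ c ℕ.* b)) (b ℕ.* d) {{ℕ.m*n≢0 b d}}
  ÷-+ a (suc b) c (suc d) = ℚ.toℚᵘ-injective (begin
    toℚᵘ ((+ a) ÷ suc b + (+ c) ÷ suc d)
      ≈⟨ ℚ.toℚᵘ-homo-+ ((+ a) ÷ suc b) ((+ c) ÷ suc d) ⟩
    toℚᵘ ((+ a) ÷ suc b) ℚᵘ.+ toℚᵘ ((+ c) ÷ suc d)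
      ≈⟨ ℚᵘ.+-cong (toℚᵘ-÷ a (suc b)) (toℚᵘ-÷ c (suc d)) ⟩
    mkℚᵘ (+ a) b ℚᵘ.+ mkℚᵘ (+ c) d
      ≡⟨ cong (λ n → n ÷ᵘ (suc b ℕ.* suc d)) numerator ⟩
    (+ (a ℕ.* suc d ℕ.+ c ℕ.* suc b)) ÷ᵘ (suc b ℕ.* suc d)
      ≈⟨ toℚᵘ-÷ _ (suc b ℕ.* suc d) ⟨
    toℚᵘ ((+ (a ℕ.* suc d ℕ.+ c ℕ.* suc b)) ÷ (suc b ℕ.* suc d)) ∎)
    where
    open ℚᵘ.≃-Reasoning
    numerator : + a ℤ.* + suc d ℤ.+ + c ℤ.* + suc b ≡ + (a ℕ.* suc d ℕ.+ c ℕ.* suc b)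
    numerator = trans (cong₂ ℤ._+_ (sym (ℤ.pos-* a (suc d))) (sym (ℤ.pos-* c (suc b))))
      (sym (ℤ.pos-+ (a ℕ.* suc d) _))

  ÷-* : ∀ a b c d .{{_ : NonZero b}} .{{_ : NonZero d}} →
    (+ a) ÷ b * ((+ c) ÷ d) ≡ _÷_ (+ (a ℕ.* c)) (b ℕ.* d) {{ℕ.m*n≢0 b d}}
  ÷-* a (suc b) c (suc d) = ℚ.toℚᵘ-injective (begin
    toℚᵘ ((+ a) ÷ suc b * ((+ c) ÷ suc d))
      ≈⟨ ℚ.toℚᵘ-homo-* ((+ a) ÷ suc b) ((+ c) ÷ suc d) ⟩
    toℚᵘ ((+ a) ÷ suc b) ℚᵘ.* toℚᵘ ((+ c) ÷ suc d)
      ≈⟨ ℚᵘ.*-cong (toℚᵘ-÷ a (suc b)) (toℚᵘ-÷ c (suc d)) ⟩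
    mkℚᵘ (+ a) b ℚᵘ.* mkℚᵘ (+ c) d
      ≡⟨ cong (λ n → n ÷ᵘ (suc b ℕ.* suc d)) (sym (ℤ.pos-* a c)) ⟩
    (+ (a ℕ.* c)) ÷ᵘ (suc b ℕ.* suc d)
      ≈⟨ toℚᵘ-÷ _ (suc b ℕ.* suc d) ⟨
    toℚᵘ ((+ (a ℕ.* c)) ÷ (suc b ℕ.* suc d)) ∎)
    where open ℚᵘ.≃-Reasoning

  closed-form : ∀ s D k → (+ s ÷ 2) * (+ D ÷ 1) + (+ s ÷ 1) * (k over2^ D)
    ≡ _÷_ (+ (s ℕ.* (D ℕ.* 2 ℕ.^ D ℕ.+ 2 ℕ.* k))) (2 ℕ.^ suc D) {{ℕ.m^n≢0 2 (suc D)}}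
  closed-form s D k = begin
    (+ s ÷ 2) * (+ D ÷ 1) + (+ s ÷ 1) * (+ k ÷ P)
      ≡⟨ cong₂ _+_ (÷-* s 2 D 1) (÷-* s 1 k P) ⟩
    (+ (s ℕ.* D)) ÷ (2 ℕ.* 1) + (+ (s ℕ.* k)) ÷ (1 ℕ.* P)
      ≡⟨ ÷-+ (s ℕ.* D) (2 ℕ.* 1) (s ℕ.* k) (1 ℕ.* P) ⟩
    (+ (s ℕ.* D ℕ.* (1 ℕ.* P) ℕ.+ s ℕ.* k ℕ.* (2 ℕ.* 1))) ÷ (2 ℕ.* 1 ℕ.* (1 ℕ.* P))
      ≡⟨ ÷-cross (s ℕ.* D ℕ.* (1 ℕ.* P) ℕ.+ s ℕ.* k ℕ.* (2 ℕ.* 1)) (2 ℕ.* 1 ℕ.* (1 ℕ.* P))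
                 (s ℕ.* (D ℕ.* P ℕ.+ 2 ℕ.* k)) (2 ℕ.* P) (arith s D k P) ⟩
    (+ (s ℕ.* (D ℕ.* P ℕ.+ 2 ℕ.* k))) ÷ 2 ℕ.^ suc D ∎
    where
    open ≡-Reasoning
    P = 2 ℕ.^ D
    instance
      P≢0 : NonZero P
      P≢0 = ℕ.m^n≢0 2 D
      1*P≢0 : NonZero (1 ℕ.* P)
      1*P≢0 = ℕ.m*n≢0 1 P
      2*1*[1*P]≢0 : NonZero (2 ℕ.* 1 ℕ.* (1 ℕ.* P))
      2*1*[1*P]≢0 = ℕ.m*n≢0 (2 ℕ.* 1) (1 ℕ.* P)
      2P≢0 : NonZero (2 ℕ.* P)
      2P≢0 = ℕ.m*n≢0 2 P
    arith : ∀ s D k P → (s ℕ.* D ℕ.* (1 ℕ.* P) ℕ.+ s ℕ.* k ℕ.* (2 ℕ.* 1)) ℕ.* (2 ℕ.* P)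
                      ≡ s ℕ.* (D ℕ.* P ℕ.+ 2 ℕ.* k) ℕ.* (2 ℕ.* 1 ℕ.* (1 ℕ.* P))
    arith = solve-∀

  ∣÷-÷∣ : ∀ w m a B →
    toℚᵘ ∣ (+ w) ÷ suc m - (+ a) ÷ suc B ∣
      ℚᵘ.≃ (+ ℤ.∣ (suc B ℕ.* w) ⊖ (a ℕ.* suc m) ∣) ÷ᵘ (suc m ℕ.* suc B)
  ∣÷-÷∣ w m a B = begin
    toℚᵘ ∣ x - y ∣
      ≈⟨ ℚ.toℚᵘ-homo-∣-∣ (x - y) ⟩
    ℚᵘ.∣ toℚᵘ (x + - y) ∣
      ≈⟨ ℚᵘ.∣-∣-cong (ℚ.toℚᵘ-homo-+ x (- y)) ⟩
    ℚᵘ.∣ toℚᵘ x ℚᵘ.+ toℚᵘ (- y) ∣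
      ≈⟨ ℚᵘ.∣-∣-cong (ℚᵘ.+-cong (toℚᵘ-÷ w (suc m))
           (ℚᵘ.≃-trans (ℚ.toℚᵘ-homo‿- y) (ℚᵘ.-‿cong (toℚᵘ-÷ a (suc B))))) ⟩
    ℚᵘ.∣ mkℚᵘ (+ w) m ℚᵘ.+ ℚᵘ.- mkℚᵘ (+ a) B ∣
      ≡⟨ cong (λ z → (+ ℤ.∣ z ∣) ÷ᵘ (suc m ℕ.* suc B)) numerator ⟩
    (+ ℤ.∣ (suc B ℕ.* w) ⊖ (a ℕ.* suc m) ∣) ÷ᵘ (suc m ℕ.* suc B) ∎
    where
    open ℚᵘ.≃-Reasoning
    x = (+ w) ÷ suc m
    y = (+ a) ÷ suc B
    numerator : + w ℤ.* + suc B ℤ.+ ℤ.- (+ a) ℤ.* + suc m ≡ (suc B ℕ.* w) ⊖ (a ℕ.* suc m)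
    numerator = trans
      (cong₂ ℤ._+_ (sym (ℤ.pos-* w (suc B)))
        (trans (sym (ℤ.neg-distribˡ-* (+ a) (+ suc m))) (cong ℤ.-_ (sym (ℤ.pos-* a (suc m))))))
      (trans (cong (λ z → + z ℤ.+ ℤ.- (+ (a ℕ.* suc m))) (ℕ.*-comm w (suc B)))
        (ℤ.m-n≡m⊖n (suc B ℕ.* w) (a ℕ.* suc m)))

  ≈±⇒∣⊖∣≤ : ∀ {x y e} → x ≈ y ± e → ℤ.∣ x ⊖ y ∣ ℕ.≤ e
  ≈±⇒∣⊖∣≤ {x} {y} (±-intro x≤ y≤) with ℕ.≤-total x y
  ... | inj₁ x≤y = ℕ.≤-trans (ℕ.≤-reflexive (ℤ.∣⊖∣-≤ x≤y)) (ℕ.m≤n+o⇒m∸n≤o y x y≤)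
  ... | inj₂ y≤x =
    ℕ.≤-trans (ℕ.≤-reflexive (trans (ℤ.∣m⊖n∣≡∣n⊖m∣ x y) (ℤ.∣⊖∣-≤ y≤x))) (ℕ.m≤n+o⇒m∸n≤o x y x≤)

  [2+d]*e≤n⇒e*[1+d]<n : ∀ d e N → suc (suc d) ℕ.* e ℕ.≤ N → 1 ℕ.≤ N → e ℕ.* suc d ℕ.< N
  [2+d]*e≤n⇒e*[1+d]<n d zero    N _ 1≤N = 1≤N
  [2+d]*e≤n⇒e*[1+d]<n d (suc e) N le _  =
    ℕ.≤-trans (s≤s (ℕ.≤-trans (ℕ.≤-reflexive (ℕ.*-comm (suc e) (suc d))) (ℕ.m≤n+m _ e))) le

  HasSlope⇒ConvergesTo : ∀ {W a b e} .{{_ : NonZero b}} → Sublinear e → HasSlope W a b e →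
    ConvergesTo (λ M → (+ W (suc M)) ÷ suc M) ((+ a) ÷ b)
  HasSlope⇒ConvergesTo {b = zero} {{()}}
  HasSlope⇒ConvergesTo {b = suc B} _ _ (mkℚ (+ zero) _ _) (*<* (+<+ ()))
  HasSlope⇒ConvergesTo {b = suc B} _ _ (mkℚ -[1+ _ ] _ _) (*<* ())
  HasSlope⇒ConvergesTo {W} {a} {suc B} {e} sub slope (mkℚ +[1+ p ] d _) _ = M₀ , close
    where
    -- Beyond M₀, (d + 2) e N ≤ N, so the distance e N / (b N) is below 1 / (d + 1) ≤ ε.
    M₀ = proj₁ (sub (suc (suc d)))
    close : ∀ M → M₀ ℕ.≤ M → ∣ (+ W (suc M)) ÷ suc M - (+ a) ÷ suc B ∣ < mkℚ +[1+ p ] d _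
    close M M₀≤M = ℚ.toℚᵘ-cancel-< (ℚᵘ.<-respˡ-≃ (ℚᵘ.≃-sym (∣÷-÷∣ (W N) M a B))
      (ℚᵘ.*<* (subst₂ ℤ._<_ (ℤ.pos-* difference (suc d)) (ℤ.pos-* (suc p) (N ℕ.* suc B)) (+<+ small))))
      where
      N = suc M
      difference = ℤ.∣ (suc B ℕ.* W N) ⊖ (a ℕ.* N) ∣
      small : difference ℕ.* suc d ℕ.< suc p ℕ.* (N ℕ.* suc B)
      small = ℕ.<-≤-trans
        (ℕ.≤-<-trans (ℕ.*-monoˡ-≤ (suc d) (≈±⇒∣⊖∣≤ (≈-at slope N)))
          ([2+d]*e≤n⇒e*[1+d]<n d (e N) N (proj₂ (sub (suc (suc d))) N (ℕ.≤-trans M₀≤M (ℕ.n≤1+n M))) (s≤s z≤n)))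
        (ℕ.≤-trans (ℕ.m≤m*n N (suc B)) (ℕ.m≤n*m (N ℕ.* suc B) (suc p)))

  ConvergesTo-cong : ∀ {u v L} → (∀ M → u M ≡ v M) → ConvergesTo u L → ConvergesTo v L
  ConvergesTo-cong {L = L} u≡v conv ε ε>0 with conv ε ε>0
  ... | M₀ , close = M₀ , λ M M₀≤M → subst (λ q → ∣ q - L ∣ < ε) (u≡v M) (close M M₀≤M)

  ConvergesTo-+1 : ∀ {u L} → ConvergesTo (λ M → u M + 1ℚ) L → ConvergesTo u (L - 1ℚ)
  ConvergesTo-+1 {u} {L} conv ε ε>0 with conv ε ε>0
  ... | M₀ , close = M₀ , λ M M₀≤M → subst (λ q → ∣ q ∣ < ε) (shift (u M) L) (close M M₀≤M)
    where
    open +-*-Solver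
    shift : ∀ x L → x + 1ℚ - L ≡ x - (L - 1ℚ)
    shift = solve 2 (λ x L → x :+ con 1ℚ :- L := x :- (L :- con 1ℚ)) refl

  windowSum-suc : ∀ f k N → windowSum (λ k n → suc (f k n)) k N ≡ windowSum f k N ℕ.+ N
  windowSum-suc f k zero    = refl
  windowSum-suc f k (suc N) = trans (cong (ℕ._+ suc (f k (k ℕ.+ N))) (windowSum-suc f k N)) (arith _ _ _)
    where
    arith : ∀ w n x → w ℕ.+ n ℕ.+ suc x ≡ w ℕ.+ x ℕ.+ suc n
    arith = solve-∀

  average-suc : ∀ f k M → average (λ k n → suc (f k n)) k M ≡ average f k M + 1ℚ
  average-suc f k M = begin
    (+ windowSum (λ k n → suc (f k n)) k N) ÷ N  ≡⟨ cong (λ w → (+ w) ÷ N) (windowSum-suc f k N) ⟩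
    (+ (W ℕ.+ N)) ÷ N
      ≡⟨ ÷-cross (W ℕ.+ N) N (W ℕ.* 1 ℕ.+ 1 ℕ.* N) (N ℕ.* 1) (arith W N) ⟩
    (+ (W ℕ.* 1 ℕ.+ 1 ℕ.* N)) ÷ (N ℕ.* 1)       ≡⟨ ÷-+ W N 1 1 ⟨
    (+ W) ÷ N + 1ℚ                               ∎
    where
    open ≡-Reasoning
    N = suc M
    W = windowSum f k N
    arith : ∀ W N → (W ℕ.+ N) ℕ.* (N ℕ.* 1) ≡ (W ℕ.* 1 ℕ.+ 1 ℕ.* N) ℕ.* N
    arith = solve-∀

  AmortizedValue-suc : ∀ {f k L} → AmortizedValue (λ k n → suc (f k n)) k L → AmortizedValue f k (L - 1ℚ)
  AmortizedValue-suc {f} {k} {L} conv = ConvergesTo-+1 {average f k} {L} (ConvergesTo-cong (average-suc f k) conv)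

  amortizedValue : ∀ {f α β} → HalvingRecurrence f α β →
    ∀ {e₁} → Sublinear e₁ → HasSlope (cumulative f 1) (α ℕ.+ β) 1 e₁ → ∀ k → 1 ℕ.≤ k →
    AmortizedValue f k ((+ (α ℕ.+ β) ÷ 2) * (+ ⌈log₂ k ⌉ ÷ 1) + (+ (α ℕ.+ β) ÷ 1) * (k over2^ ⌈log₂ k ⌉))
  amortizedValue {f} {α} {β} rec sub₁ slope₁ k 1≤k
    with cumulative-slope rec sub₁ slope₁ ⌈log₂ k ⌉ (⌈log₂⌉-bracket 1≤k)
  ... | e , sub , slope = subst (AmortizedValue f k) (sym (closed-form (α ℕ.+ β) ⌈log₂ k ⌉ k))
    (HasSlope⇒ConvergesTo {{ℕ.m^n≢0 2 (suc ⌈log₂ k ⌉)}}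
      (Sublinear-+ (Sublinear-∘+ k sub) (Sublinear-const _))
      (HasSlope-cong (λ N → sym (windowSum≡cumulative f k N)) (HasSlope-shift k slope)))

open import Data.Nat using (ℕ; _≤_)
open import Data.Nat.Logarithm using (⌈log₂_⌉)
open import Data.Integer using (+_)
open import Data.Product using (_×_; _,_)
open import Data.Rational using (1ℚ; _+_; _-_; _*_) renaming (_/_ to _÷_)
open import Data.Rational.Properties using (*-identityˡ)
open import Relation.Binary.PropositionalEquality using (subst; cong)
open Slopes using (Sublinear-const; Sublinear-logError)
open Amortization using (rFMMR-halving; rFMMR-slope-one; σFMMR+1-halving; σFMMR+1-slope-one)
open Limits using (amortizedValue; AmortizedValue-suc)

corollary1 : ∀ (k : ℕ) → 1 ≤ k →
    AmortizedValue rFMMR k ((+ 1 ÷ 2) * (+ ⌈log₂ k ⌉ ÷ 1) + (k over2^ ⌈log₂ k ⌉))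
    × AmortizedValue σFMMR k
        ((+ 3 ÷ 2) * (+ ⌈log₂ k ⌉ ÷ 1) + (+ 3 ÷ 1) * (k over2^ ⌈log₂ k ⌉) - 1ℚ)
corollary1 k 1≤k =
  subst (AmortizedValue rFMMR k)
    (cong (λ q → (+ 1 ÷ 2) * (+ ⌈log₂ k ⌉ ÷ 1) + q) (*-identityˡ (k over2^ ⌈log₂ k ⌉)))
    (amortizedValue rFMMR-halving (Sublinear-const 1) rFMMR-slope-one k 1≤k) ,
  AmortizedValue-suc (amortizedValue σFMMR+1-halving (Sublinear-logError 5) σFMMR+1-slope-one k 1≤k)
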